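{- Let $\pi\in S_k$ be a layered permutation, and let $\ell$ be the number of non-final layers of $\pi$ of size at least $2$. Then for all integers $r>1$, $P(\pi,r)\ge P_{\mathrm{weak}}(\pi,r)$, and $P_{\mathrm{weak}}(\pi,r)=\Omega\left(r(\log_2 r)^{k-\ell-1}\right)$ as $r\to\infty$.
   Context: A layered permutation $\pi\in S_k$ is one obtained from the descending permutation $k,k-1,\dots,1$ by reversing some of its contiguous blocks (descending runs). A layer is a maximal contiguous ascending run of $\pi$; its size is its number of entries; a non-final layer is a layer that is not at the end of $\pi$. A $\pi$-wave is an increasing sequence of integers $x_1<\cdots<x_{k+1}$ such that for all $1\le i,j\le k$, $x_{i+1}-x_i > x_{j+1}-x_j$ if and only if $\pi(i)>\pi(j)$; a weak-difference $\pi$-wave is an increasing sequence $x_1<\cdots<x_{k+1}$ such that $x_{i+1}-x_i\ge x_{j+1}-x_j$ whenever $\pi(i)>\pi(j)$. $P(\pi,r)$ (resp. $P_{\mathrm{weak}}(\pi,r)$) is the least positive integer $M$ such that every coloring of $[M]$ with $r$ colors contains a monochromatic $\pi$-wave (resp. monochromatic weak-difference $\pi$-wave). Implied constants may depend on $\pi$. -}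

module Defs where

open import Data.Nat using (ℕ; zero; suc; _+_; _*_; _∸_; _^_; _≤_; _<_; _<ᵇ_; _≤?_)
open import Data.Nat.Logarithm using (⌊log₂_⌋)
open import Data.Bool using (true; false)
open import Data.Fin using (Fin; toℕ; inject₁) renaming (zero to fzero; suc to fsuc)
open import Data.Fin.Permutation using (Permutation′; _⟨$⟩ʳ_)
open import Data.List using (List; []; _∷_; [_]; foldr; map; length; take; filter; concat; reverse; downFrom; allFin; drop)
open import Data.Nat.ListAction using (sum)
open import Data.Product using (Σ; ∃; _×_; _,_)
open import Relation.Binary.PropositionalEquality using (_≡_)

-- π as the list of its values π(1),…,π(k) (0-indexed values 0..k-1)
permList : ∀ {k} → Permutation′ k → List ℕ
permList {k} π = map (λ i → toℕ (π ⟨$⟩ʳ i)) (allFin k)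

chunks : List ℕ → List ℕ → List (List ℕ)
chunks []       xs = []
chunks (b ∷ bs) xs = take b xs ∷ chunks bs (drop b xs)

-- the descending permutation k,k-1,…,1 (0-indexed: k-1,…,0) with each of the
-- contiguous blocks of sizes bs reversed
layeredList : (k : ℕ) → List ℕ → List ℕ
layeredList k bs = concat (map reverse (chunks bs (downFrom k)))

IsLayered : ∀ {k} → Permutation′ k → Set
IsLayered {k} π = Σ (List ℕ) λ bs → (sum bs ≡ k) × (permList π ≡ layeredList k bs)

-- split a list into its maximal contiguous ascending runs (layers)
addFront : ℕ → List (List ℕ) → List (List ℕ)
addFront x []                 = [ x ] ∷ []
addFront x ([] ∷ rs)          = [ x ] ∷ rs
addFront x ((y ∷ ys) ∷ rs) with x <ᵇ y
... | true  = (x ∷ y ∷ ys) ∷ rs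
... | false = [ x ] ∷ (y ∷ ys) ∷ rs

layers : List ℕ → List (List ℕ)
layers = foldr addFront []

nonFinalLayers : ∀ {k} → Permutation′ k → List (List ℕ)
nonFinalLayers π = let ls = layers (permList π) in take (length ls ∸ 1) ls

numBigNonFinal : ∀ {k} → Permutation′ k → ℕ
numBigNonFinal π = length (filter (λ L → 2 ≤? length L) (nonFinalLayers π))

diff : ∀ {k} → (Fin (suc k) → ℕ) → Fin k → ℕ
diff x i = x (fsuc i) ∸ x (inject₁ i)

Increasing : ∀ {k} → (Fin (suc k) → ℕ) → Set
Increasing {k} x = (i : Fin k) → x (inject₁ i) < x (fsuc i)

IsWave : ∀ {k} → Permutation′ k → (Fin (suc k) → ℕ) → Set
IsWave {k} π x = Increasing x ×
  ((i j : Fin k) → (diff x j < diff x i → toℕ (π ⟨$⟩ʳ j) < toℕ (π ⟨$⟩ʳ i))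
                 × (toℕ (π ⟨$⟩ʳ j) < toℕ (π ⟨$⟩ʳ i) → diff x j < diff x i))

IsWeakWave : ∀ {k} → Permutation′ k → (Fin (suc k) → ℕ) → Set
IsWeakWave {k} π x = Increasing x ×
  ((i j : Fin k) → toℕ (π ⟨$⟩ʳ j) < toℕ (π ⟨$⟩ʳ i) → diff x j ≤ diff x i)

-- every r-colouring of [M] = {1,…,M} contains a monochromatic W-sequence.
-- A colouring is given as χ : ℕ → Fin r; only its values on [M] matter.
Forces : ∀ {k} → ((Fin (suc k) → ℕ) → Set) → ℕ → ℕ → Set
Forces {k} W r M = (χ : ℕ → Fin r) → Σ (Fin (suc k) → ℕ) λ x →
  W x × ((i : Fin (suc k)) → (1 ≤ x i) × (x i ≤ M) × (χ (x i) ≡ χ (x fzero)))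

IsLeastForcing : ∀ {k} → ((Fin (suc k) → ℕ) → Set) → ℕ → ℕ → Set
IsLeastForcing W r M = (1 ≤ M) × Forces W r M × ((M′ : ℕ) → 1 ≤ M′ → Forces W r M′ → M ≤ M′)

IsP : ∀ {k} → Permutation′ k → ℕ → ℕ → Set
IsP π r M = IsLeastForcing (IsWave π) r M

IsPweak : ∀ {k} → Permutation′ k → ℕ → ℕ → Set
IsPweak π r M = IsLeastForcing (IsWeakWave π) r M

-- A π-wave is in particular a weak π-wave, whence P(π, r) ≥ P_weak(π, r).
--
-- For the lower bound let E = k − ℓ − 1 and colour n < K M ^ E, where M = T · 4 ^ T, by its
-- quotient n / M ^ E together with a key of each of its E lowest base-M digits. There are
-- fewer than C = 2 · 4 ^ T keys, and digits sharing a key are spread out with strictly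
-- shrinking gaps, or strictly growing ones for the mirrored key; which of the two is used at
-- each digit position is dictated by the layer sizes of π. Call the highest digit on which the
-- endpoints of a gap of a monochromatic sequence differ its level. Gaps at a higher level are
-- wider, and two gaps at the same level with only lower gaps between them follow the trend of
-- that level. A weak π-wave would therefore have to climb through more levels than the E
-- available inside some layer, or break the growth prescribed for a singleton layer. Taking
-- T ≈ log₂ r / 6(E + 1) and K = ⌊r / C ^ E⌋ gives P_weak(π, r) > K M ^ E ≳ r (log₂ r) ^ E.

module Submission where

open import Defs
open import Data.Bool using (Bool; true; false; if_then_else_)
import Data.Bool as Bool
open import Data.Empty using (⊥; ⊥-elim)
open import Data.Fin using (Fin; toℕ; inject₁) renaming (zero to fzero; suc to fsuc)
open import Data.Fin.Permutation using (Permutation′; _⟨$⟩ʳ_)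
open import Data.List using (List; []; _∷_; _++_; [_]; _∷ʳ_; length; map; take; drop; reverse; foldr; filter; downFrom; tabulate)
open import Data.List.Properties using (unfold-reverse; foldr-++; length-map; ∷-injective; map-∘; map-tabulate)
open import Data.List.Membership.Propositional using (_∈_)
open import Data.List.Membership.Propositional.Properties using (∈-++⁺ˡ; ∈-++⁺ʳ; ∈-map⁻)
open import Data.List.Relation.Unary.Any using (here; there)
open import Data.List.Relation.Unary.All as All using (All; []; _∷_)
open import Data.List.Relation.Unary.All.Properties using (++⁺; ++⁻ˡ; ++⁻ʳ; map⁻)
open import Data.List.Relation.Unary.Linked using (Linked; []; [-]; _∷_)
open import Data.Nat
open import Data.Nat.DivMod
open import Data.Nat.ListAction using (sum)
open import Data.Nat.Logarithm using (⌊log₂_⌋; ⌊log₂⌋-mono-≤; ⌊log₂[2^n]⌋≡n; ⌊log₂⌊n/2⌋⌋≡⌊log₂n⌋∸1)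
open import Data.Nat.Properties
open import Algebra.Properties.CommutativeSemigroup +-commutativeSemigroup using (interchange)
open import Data.Nat.Tactic.RingSolver using (solve-∀)
open import Data.Product using (Σ; ∃; ∃₂; _×_; _,_; proj₁; proj₂)
open import Data.Sum using (_⊎_; inj₁; inj₂)
open import Data.Unit using (⊤; tt)
open import Function.Base using (_on_)
open import Relation.Binary using (tri<; tri≈; tri>)
open import Relation.Binary.PropositionalEquality hiding ([_])
open import Relation.Nullary using (¬_; yes; no)

-- Gap profiles

-- A gap x_j < x_(j+1) of a sequence, remembered by π(j), the difference x_(j+1) − x_j,
-- and a level.
record Gap : Set where
  constructor gap
  field
    value width level : ℕ
open Gap

<ᵇ≡true⇒< : ∀ m n → (m <ᵇ n) ≡ true → m < n
<ᵇ≡true⇒< m n eq = <ᵇ⇒< m n (subst Bool.T (sym eq) tt)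

<ᵇ≡false⇒≥ : ∀ m n → (m <ᵇ n) ≡ false → n ≤ m
<ᵇ≡false⇒≥ m n eq = ≮⇒≥ (λ m<n → subst Bool.T eq (<⇒<ᵇ m<n))

Trend : Bool → ℕ → ℕ → Set
Trend true  x y = y < x
Trend false x y = x < y

-- The first gap of the list whose level is at least level t, if its level is
-- exactly level t, follows t in the trend τ prescribes for that level.
mutual
  NextPeerTrend : (ℕ → Bool) → Gap → List Gap → Set
  NextPeerTrend τ t []       = ⊤
  NextPeerTrend τ t (u ∷ us) = NextPeerTrendAt (level u <ᵇ level t) τ t u us

  NextPeerTrendAt : Bool → (ℕ → Bool) → Gap → Gap → List Gap → Set
  NextPeerTrendAt true  τ t u us = NextPeerTrend τ t us
  NextPeerTrendAt false τ t u us = level u ≡ level t → Trend (τ (level t)) (width t) (width u)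

PeerTrends : (ℕ → Bool) → List Gap → Set
PeerTrends τ []       = ⊤
PeerTrends τ (t ∷ ts) = NextPeerTrend τ t ts × PeerTrends τ ts

WiderAbove : List Gap → Set
WiderAbove zs = ∀ {a b} → a ∈ zs → b ∈ zs → level b < level a → width b < width a

LevelsWithin : ℕ → List Gap → Set
LevelsWithin E = All (λ u → 1 ≤ level u × level u ≤ E)

-- With R the order on values this is the layer structure of a layered permutation.
data Layered (R : Gap → Gap → Set) : List ℕ → List Gap → Set where
  []    : Layered R [] []
  layer : ∀ {ss bk} f fr → Linked R (f ∷ fr) → All (λ u → R u f) bk → Layered R ss bk →
          Layered R (suc (length fr) ∷ ss) ((f ∷ fr) ++ bk)

levelCount : List ℕ → ℕ
levelCount []            = 0
levelCount (s ∷ [])      = s ∸ 1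
levelCount (s ∷ s′ ∷ ss) = suc (s ∸ 2) + levelCount (s′ ∷ ss)

-- The levels above levelCount (s′ ∷ ss) belong to the first layer; they shrink
-- unless that layer is a singleton.
levelTrend : List ℕ → ℕ → Bool
levelTrend []            v = true
levelTrend (s ∷ [])      v = true
levelTrend (s ∷ s′ ∷ ss) v =
  if levelCount (s′ ∷ ss) <ᵇ v then 1 <ᵇ s else levelTrend (s′ ∷ ss) v

levelTrend-below : ∀ s s′ ss v → v ≤ levelCount (s′ ∷ ss) →
  levelTrend (s ∷ s′ ∷ ss) v ≡ levelTrend (s′ ∷ ss) v
levelTrend-below s s′ ss v v≤E with levelCount (s′ ∷ ss) <ᵇ v in eq
... | true  = ⊥-elim (<⇒≱ (<ᵇ≡true⇒< _ _ eq) v≤E)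
... | false = refl

levelTrend-above : ∀ s s′ ss v → levelCount (s′ ∷ ss) < v →
  levelTrend (s ∷ s′ ∷ ss) v ≡ (1 <ᵇ s)
levelTrend-above s s′ ss v E<v with levelCount (s′ ∷ ss) <ᵇ v in eq
... | true  = refl
... | false = ⊥-elim (<⇒≱ E<v (<ᵇ≡false⇒≥ _ _ eq))

WiderAbove-⊆ : ∀ {ys zs} → (∀ {x} → x ∈ ys → x ∈ zs) → WiderAbove zs → WiderAbove ys
WiderAbove-⊆ ys⊆zs wide a∈ b∈ = wide (ys⊆zs a∈) (ys⊆zs b∈)

PeerTrends-++⁻ʳ : ∀ τ xs {ys} → PeerTrends τ (xs ++ ys) → PeerTrends τ ys
PeerTrends-++⁻ʳ τ []       trends       = trends
PeerTrends-++⁻ʳ τ (x ∷ xs) (_ , trends) = PeerTrends-++⁻ʳ τ xs trends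

mutual
  NextPeerTrend-cong : ∀ τ τ′ t us → τ (level t) ≡ τ′ (level t) →
    NextPeerTrend τ t us → NextPeerTrend τ′ t us
  NextPeerTrend-cong τ τ′ t []       eq next = tt
  NextPeerTrend-cong τ τ′ t (u ∷ us) eq next = NextPeerTrendAt-cong (level u <ᵇ level t) τ τ′ t u us eq next

  NextPeerTrendAt-cong : ∀ b τ τ′ t u us → τ (level t) ≡ τ′ (level t) →
    NextPeerTrendAt b τ t u us → NextPeerTrendAt b τ′ t u us
  NextPeerTrendAt-cong true  τ τ′ t u us eq next = NextPeerTrend-cong τ τ′ t us eq next
  NextPeerTrendAt-cong false τ τ′ t u us eq next same =
    subst (λ d → Trend d (width t) (width u)) eq (next same)

PeerTrends-cong : ∀ τ τ′ zs → All (λ u → τ (level u) ≡ τ′ (level u)) zs →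
  PeerTrends τ zs → PeerTrends τ′ zs
PeerTrends-cong τ τ′ []       _          _              = tt
PeerTrends-cong τ τ′ (t ∷ ts) (eq ∷ eqs) (next , trends) =
  NextPeerTrend-cong τ τ′ t ts eq next , PeerTrends-cong τ τ′ ts eqs trends

-- Each step of an ascending run climbs a level: a lower gap is narrower, and a peer
-- at a level ≥ L would have to be narrower too.
climbing-run : ∀ τ E L a as bk → Linked (_≤_ on width) (a ∷ as) →
  WiderAbove ((a ∷ as) ++ bk) → PeerTrends τ ((a ∷ as) ++ bk) →
  All (λ u → level u ≤ E) (a ∷ as) → L ≤ level a → (∀ v → L ≤ v → τ v ≡ true) →
  L + length as ≤ E
climbing-run τ E L a []       bk asc wide trends (a≤E ∷ []) L≤a shrink =
  subst (_≤ E) (sym (+-identityʳ L)) (≤-trans L≤a a≤E)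
climbing-run τ E L a (b ∷ bs) bk (a≤b ∷ asc) wide (next , trends) (a≤E ∷ bs≤E) L≤a shrink
  with level b <ᵇ level a in eq
... | true  = ⊥-elim (<⇒≱ (wide (here refl) (there (here refl)) (<ᵇ≡true⇒< _ _ eq)) a≤b)
... | false = subst (_≤ E) (sym (+-suc L (length bs)))
    (climbing-run τ E (suc L) b bs bk asc (WiderAbove-⊆ there wide) trends bs≤E
      (≤-trans (s≤s L≤a) a<b) (λ v L<v → shrink v (<⇒≤ L<v)))
  where
  a<b : level a < level b
  a<b with m≤n⇒m<n∨m≡n (<ᵇ≡false⇒≥ _ _ eq)
  ... | inj₁ a<b  = a<b
  ... | inj₂ same = ⊥-elim (<⇒≱ (subst (λ d → Trend d (width a) (width b))
                                   (shrink (level a) L≤a) (next (sym same))) a≤b)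

next-peer : ∀ τ t us {u} → NextPeerTrend τ t us → u ∈ us → level t ≤ level u →
  All (λ v → level v ≤ level t) us → ∃ λ u′ → u′ ∈ us × Trend (τ (level t)) (width t) (width u′)
next-peer τ t (v ∷ vs) next u∈ t≤u (v≤t ∷ vs≤t) with level v <ᵇ level t in eq
next-peer τ t (v ∷ vs) next (here refl) t≤u (v≤t ∷ vs≤t) | true =
  ⊥-elim (<⇒≱ (<ᵇ≡true⇒< _ _ eq) t≤u)
next-peer τ t (v ∷ vs) next (there u∈) t≤u (v≤t ∷ vs≤t) | true
  with next-peer τ t vs next u∈ t≤u vs≤t
... | u′ , u′∈ , trend = u′ , there u′∈ , trend
next-peer τ t (v ∷ vs) next u∈ t≤u (v≤t ∷ vs≤t) | false =
  v , here refl , next (≤-antisym v≤t (<ᵇ≡false⇒≥ _ _ eq))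

levels-≤-or-above : ∀ E us → All (λ u → level u ≤ E) us ⊎ ∃ λ u → u ∈ us × E < level u
levels-≤-or-above E []       = inj₁ []
levels-≤-or-above E (v ∷ vs) with level v ≤? E | levels-≤-or-above E vs
... | yes v≤E | inj₁ vs≤E              = inj₁ (v≤E ∷ vs≤E)
... | yes _   | inj₂ (u , u∈ , E<u)    = inj₂ (u , there u∈ , E<u)
... | no  v≰E | _                      = inj₂ (v , here refl , ≰⇒> v≰E)

head-above-tail : ∀ f fr bk {u} → All (λ v → width v ≤ width f) bk →
  WiderAbove ((f ∷ fr) ++ bk) → u ∈ bk → level u ≤ level f
head-above-tail f fr bk narrower wide u∈ =
  ≮⇒≥ (λ f<u → <⇒≱ (wide (∈-++⁺ʳ (f ∷ fr) u∈) (here refl) f<u) (All.lookup narrower u∈))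

-- The head of the first layer then lies above levelCount (s′ ∷ ss) as well: a singleton
-- layer would need a wider peer later on, and a longer one climbs out of range.
first-layer-above⇒⊥ : ∀ s′ ss f fr bk {u} → u ∈ bk → levelCount (s′ ∷ ss) < level u →
  level u ≤ level f → Linked (_≤_ on width) (f ∷ fr) → All (λ v → width v ≤ width f) bk →
  WiderAbove ((f ∷ fr) ++ bk) →
  PeerTrends (levelTrend (suc (length fr) ∷ s′ ∷ ss)) ((f ∷ fr) ++ bk) →
  LevelsWithin (levelCount (suc (length fr) ∷ s′ ∷ ss)) ((f ∷ fr) ++ bk) → ⊥
first-layer-above⇒⊥ s′ ss f [] bk u∈ E<u u≤f asc narrower wide (next , _) levels
  with next-peer _ f bk next u∈ (≤-trans (proj₂ (All.head levels)) E<u)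
         (All.map (λ p → ≤-trans (proj₂ p) (<-≤-trans E<u u≤f)) (++⁻ʳ [ f ] levels))
... | u′ , u′∈ , f≺u′ =
  <⇒≱ (subst (λ d → Trend d (width f) (width u′))
         (levelTrend-above 1 s′ ss (level f) (<-≤-trans E<u u≤f)) f≺u′)
      (All.lookup narrower u′∈)
first-layer-above⇒⊥ s′ ss f (g ∷ gs) bk u∈ E<u u≤f asc narrower wide trends levels =
  overflow (levelCount (s′ ∷ ss)) (length gs)
    (climbing-run (levelTrend (suc (suc (length gs)) ∷ s′ ∷ ss)) _ (suc (levelCount (s′ ∷ ss)))
      f (g ∷ gs) bk asc wide trends (All.map proj₂ (++⁻ˡ (f ∷ g ∷ gs) levels))
      (<-≤-trans E<u u≤f) (λ v E<v → levelTrend-above (suc (suc (length gs))) s′ ss v E<v))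
  where
  overflow : ∀ a b → suc a + suc b ≰ suc b + a
  overflow a b h = 1+n≰n (subst (_≤ suc b + a) (shift a b) h)
    where
    shift : ∀ a b → suc a + suc b ≡ suc (suc b + a)
    shift = solve-∀

no-weak-layered-profile : ∀ s ss zs → Layered (_≤_ on width) (s ∷ ss) zs → WiderAbove zs →
  PeerTrends (levelTrend (s ∷ ss)) zs → LevelsWithin (levelCount (s ∷ ss)) zs → ⊥
no-weak-layered-profile _ [] _ (layer f fr asc _ []) wide trends levels =
  1+n≰n (climbing-run (levelTrend [ suc (length fr) ]) (length fr) 1 f fr [] asc wide trends
           (All.map proj₂ (++⁻ˡ (f ∷ fr) levels)) (proj₁ (All.head levels)) (λ _ _ → refl))
no-weak-layered-profile _ (s′ ∷ ss) _ (layer {bk = bk} f fr asc narrower rest) wide trends levels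
  with levels-≤-or-above (levelCount (s′ ∷ ss)) bk
... | inj₂ (u , u∈ , E<u) =
  first-layer-above⇒⊥ s′ ss f fr bk u∈ E<u (head-above-tail f fr bk narrower wide u∈)
    asc narrower wide trends levels
... | inj₁ bk≤E =
  no-weak-layered-profile s′ ss bk rest (WiderAbove-⊆ (∈-++⁺ʳ (f ∷ fr)) wide)
    (PeerTrends-cong _ _ bk (All.map (λ {u} → levelTrend-below (suc (length fr)) s′ ss (level u)) bk≤E)
      (PeerTrends-++⁻ʳ _ (f ∷ fr) trends))
    (All.zipWith (λ (p , q) → proj₁ p , q) (++⁻ʳ (f ∷ fr) levels , bk≤E))

Linked-weaken : ∀ {A : Set} {R R′ : A → A → Set} {xs} → (∀ {a b} → a ∈ xs → b ∈ xs → R a b → R′ a b) →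
  Linked R xs → Linked R′ xs
Linked-weaken R⇒R′ []          = []
Linked-weaken R⇒R′ [-]         = [-]
Linked-weaken R⇒R′ (r ∷ chain) =
  R⇒R′ (here refl) (there (here refl)) r ∷ Linked-weaken (λ a∈ b∈ → R⇒R′ (there a∈) (there b∈)) chain

Layered-weaken : ∀ {R R′ : Gap → Gap → Set} {ss zs} →
  (∀ {a b} → a ∈ zs → b ∈ zs → R a b → R′ a b) → Layered R ss zs → Layered R′ ss zs
Layered-weaken R⇒R′ []                            = []
Layered-weaken R⇒R′ (layer f fr chain below rest) =
  layer f fr (Linked-weaken (λ a∈ b∈ → R⇒R′ (∈-++⁺ˡ a∈) (∈-++⁺ˡ b∈)) chain)
    (All.tabulate (λ u∈ → R⇒R′ (∈-++⁺ʳ (f ∷ fr) u∈) (here refl) (All.lookup below u∈)))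
    (Layered-weaken (λ a∈ b∈ → R⇒R′ (∈-++⁺ʳ (f ∷ fr) a∈) (∈-++⁺ʳ (f ∷ fr) b∈)) rest)

-- Layered permutations

countFrom : ℕ → ℕ → List ℕ
countFrom n zero    = []
countFrom n (suc b) = n ∷ countFrom (suc n) b

countFrom-∷ʳ : ∀ n b → countFrom n (suc b) ≡ countFrom n b ∷ʳ (b + n)
countFrom-∷ʳ n zero    = refl
countFrom-∷ʳ n (suc b) =
  cong (n ∷_) (trans (countFrom-∷ʳ (suc n) b) (cong (countFrom (suc n) b ∷ʳ_) (+-suc b n)))

length-countFrom : ∀ n b → length (countFrom n b) ≡ b
length-countFrom n zero    = refl
length-countFrom n (suc b) = cong suc (length-countFrom (suc n) b)

countFrom-< : ∀ n b → All (_< b + n) (countFrom n b)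
countFrom-< n zero    = []
countFrom-< n (suc b) =
  s≤s (m≤n+m n b) ∷ subst (λ m → All (_< m) (countFrom (suc n) b)) (+-suc b n) (countFrom-< (suc n) b)

reverse-take-downFrom : ∀ b n → reverse (take b (downFrom (b + n))) ≡ countFrom n b
reverse-take-downFrom zero    n = refl
reverse-take-downFrom (suc b) n = begin
  reverse ((b + n) ∷ take b (downFrom (b + n)))  ≡⟨ unfold-reverse (b + n) (take b (downFrom (b + n))) ⟩
  reverse (take b (downFrom (b + n))) ∷ʳ (b + n) ≡⟨ cong (_∷ʳ (b + n)) (reverse-take-downFrom b n) ⟩
  countFrom n b ∷ʳ (b + n)                       ≡⟨ countFrom-∷ʳ n b ⟨
  countFrom n (suc b)                            ∎
  where open ≡-Reasoning

drop-downFrom : ∀ b n → drop b (downFrom (b + n)) ≡ downFrom n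
drop-downFrom zero    n = refl
drop-downFrom (suc b) n = drop-downFrom b n

layeredList-∷ : ∀ b bs →
  layeredList (sum (b ∷ bs)) (b ∷ bs) ≡ countFrom (sum bs) b ++ layeredList (sum bs) bs
layeredList-∷ b bs rewrite reverse-take-downFrom b (sum bs) | drop-downFrom b (sum bs) = refl

layeredList-< : ∀ bs → All (_< sum bs) (layeredList (sum bs) bs)
layeredList-< []       = []
layeredList-< (b ∷ bs) rewrite layeredList-∷ b bs =
  ++⁺ (countFrom-< (sum bs) b) (All.map (λ x< → <-≤-trans x< (m≤n+m (sum bs) b)) (layeredList-< bs))

withoutZeros : List ℕ → List ℕ
withoutZeros []            = []
withoutZeros (zero  ∷ bs)  = withoutZeros bs
withoutZeros (suc b ∷ bs)  = suc b ∷ withoutZeros bs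

withoutZeros-positive : ∀ bs → All (1 ≤_) (withoutZeros bs)
withoutZeros-positive []           = []
withoutZeros-positive (zero  ∷ bs) = withoutZeros-positive bs
withoutZeros-positive (suc b ∷ bs) = s≤s z≤n ∷ withoutZeros-positive bs

sum-withoutZeros : ∀ bs → sum (withoutZeros bs) ≡ sum bs
sum-withoutZeros []           = refl
sum-withoutZeros (zero  ∷ bs) = sum-withoutZeros bs
sum-withoutZeros (suc b ∷ bs) = cong (suc b +_) (sum-withoutZeros bs)

map-≡-++⁻ : ∀ {A B : Set} (f : A → B) ys (P R : List B) → map f ys ≡ P ++ R →
  Σ (List A) λ ys₁ → Σ (List A) λ ys₂ → (ys ≡ ys₁ ++ ys₂) × (map f ys₁ ≡ P) × (map f ys₂ ≡ R)
map-≡-++⁻ f ys       []      R eq = [] , ys , refl , refl , eq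
map-≡-++⁻ f (y ∷ ys) (p ∷ P) R eq with ∷-injective eq
... | refl , eq′ with map-≡-++⁻ f ys P R eq′
...   | ys₁ , ys₂ , refl , refl , eq₂ = y ∷ ys₁ , ys₂ , refl , refl , eq₂

countFrom-Linked : ∀ ys n b → map value ys ≡ countFrom n b → Linked (_<_ on value) ys
countFrom-Linked []            n b             eq = []
countFrom-Linked (y ∷ [])      n b             eq = [-]
countFrom-Linked (y ∷ y′ ∷ ys) n (suc (suc b)) eq =
  subst₂ _<_ (sym (proj₁ (∷-injective eq))) (sym (proj₁ (∷-injective (proj₂ (∷-injective eq))))) ≤-refl
  ∷ countFrom-Linked (y′ ∷ ys) (suc n) (suc b) (proj₂ (∷-injective eq))

layeredList-Layered : ∀ bs ys → map value ys ≡ layeredList (sum bs) bs →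
  Layered (_<_ on value) (withoutZeros bs) ys
layeredList-Layered []           []       eq = []
layeredList-Layered (zero  ∷ bs) ys       eq = layeredList-Layered bs ys (trans eq (layeredList-∷ zero bs))
layeredList-Layered (suc b ∷ bs) ys       eq
  with map-≡-++⁻ value ys (countFrom (sum bs) (suc b)) (layeredList (sum bs) bs)
         (trans eq (layeredList-∷ (suc b) bs))
... | f ∷ fr , bk , refl , head-eq , tail-eq =
  subst (λ m → Layered (_<_ on value) (suc m ∷ withoutZeros bs) ((f ∷ fr) ++ bk)) length-fr
    (layer f fr (countFrom-Linked (f ∷ fr) (sum bs) (suc b) head-eq)
      (subst (λ m → All (λ u → value u < m) bk) (sym value-f)
        (map⁻ (subst (All (_< sum bs)) (sym tail-eq) (layeredList-< bs))))
      (layeredList-Layered bs bk tail-eq))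
  where
  value-f : value f ≡ sum bs
  value-f = proj₁ (∷-injective head-eq)
  length-fr : length fr ≡ b
  length-fr = suc-injective (trans (sym (length-map value (f ∷ fr)))
                (trans (cong length head-eq) (length-countFrom (sum bs) (suc b))))

StartsBelow : ℕ → List (List ℕ) → Set
StartsBelow h []             = ⊤
StartsBelow h ([] ∷ _)       = ⊥
StartsBelow h ((y ∷ _) ∷ _)  = y < h

StartsBelow-suc : ∀ h ls → StartsBelow h ls → StartsBelow (suc h) ls
StartsBelow-suc h []            _   = tt
StartsBelow-suc h ((y ∷ _) ∷ _) y<h = m<n⇒m<1+n y<h

addFront-countFrom : ∀ a b ls → StartsBelow a ls →
  foldr addFront ls (countFrom a (suc b)) ≡ countFrom a (suc b) ∷ ls
addFront-countFrom a zero    []              _   = refl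
addFront-countFrom a zero    ((y ∷ ys) ∷ ls) y<a with a <ᵇ y in eq
... | true  = ⊥-elim (<⇒≱ y<a (<⇒≤ (<ᵇ≡true⇒< a y eq)))
... | false = refl
addFront-countFrom a (suc b) ls below
  rewrite addFront-countFrom (suc a) b ls (StartsBelow-suc a ls below) with a <ᵇ suc a in eq
... | true  = refl
... | false = ⊥-elim (1+n≰n (<ᵇ≡false⇒≥ a (suc a) eq))

layers-layeredList : ∀ bs →
  map length (layers (layeredList (sum bs) bs)) ≡ withoutZeros bs ×
  StartsBelow (sum bs) (layers (layeredList (sum bs) bs))
layers-layeredList []           = refl , tt
layers-layeredList (zero  ∷ bs) rewrite layeredList-∷ zero bs = layers-layeredList bs
layers-layeredList (suc b ∷ bs)
  rewrite layeredList-∷ (suc b) bs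
        | foldr-++ addFront [] (countFrom (sum bs) (suc b)) (layeredList (sum bs) bs)
        | addFront-countFrom (sum bs) b (layers (layeredList (sum bs) bs)) (proj₂ (layers-layeredList bs))
  = cong₂ _∷_ (length-countFrom (sum bs) (suc b)) (proj₁ (layers-layeredList bs)) , s≤s (m≤n+m (sum bs) b)

bigNonFinal : List ℕ → ℕ
bigNonFinal xs = length (filter (2 ≤?_) (take (length xs ∸ 1) xs))

count-big-take : ∀ n (ls : List (List ℕ)) →
  length (filter (λ L → 2 ≤? length L) (take n ls)) ≡ length (filter (2 ≤?_) (take n (map length ls)))
count-big-take zero    ls       = refl
count-big-take (suc n) []       = refl
count-big-take (suc n) (L ∷ ls) with 1 <ᵇ length L
... | true  = cong suc (count-big-take n ls)
... | false = count-big-take n ls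

bigNonFinal-layers : ∀ (ls : List (List ℕ)) →
  length (filter (λ L → 2 ≤? length L) (take (length ls ∸ 1) ls)) ≡ bigNonFinal (map length ls)
bigNonFinal-layers ls =
  trans (count-big-take (length ls ∸ 1) ls)
    (cong (λ n → length (filter (2 ≤?_) (take (n ∸ 1) (map length ls)))) (sym (length-map length ls)))

levelCount+1+bigNonFinal : ∀ s ss → All (1 ≤_) (s ∷ ss) →
  levelCount (s ∷ ss) + 1 + bigNonFinal (s ∷ ss) ≡ sum (s ∷ ss)
levelCount+1+bigNonFinal (suc t)       []        (_ ∷ _)        = one-layer t
  where
  one-layer : ∀ t → t + 1 + 0 ≡ suc t + 0
  one-layer = solve-∀
levelCount+1+bigNonFinal (suc zero)    (s′ ∷ ss) (_ ∷ positive) =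
  cong suc (levelCount+1+bigNonFinal s′ ss positive)
levelCount+1+bigNonFinal (suc (suc t)) (s′ ∷ ss) (_ ∷ positive) =
  trans (big-layer t (levelCount (s′ ∷ ss)) (bigNonFinal (s′ ∷ ss)))
    (cong (suc (suc t) +_) (levelCount+1+bigNonFinal s′ ss positive))
  where
  big-layer : ∀ t E c → suc t + E + 1 + suc c ≡ suc (suc t) + (E + 1 + c)
  big-layer = solve-∀

-- Keys whose blocks have shrinking or growing gaps

-- Writing B = q T + j with j < T, blocks sharing the key q + 4 ^ j have strictly
-- decreasing residues j and quotients 3 · 4 ^ j apart, so their gaps shrink.
module Keys (t : ℕ) where

  T : ℕ
  T = suc t

  shrinkingKey : ℕ → ℕ
  shrinkingKey B = B / T + 4 ^ (B % T)

  private
    divMod : ∀ B → B ≡ B % T + B / T * T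
    divMod B = m≡m%n+[m/n]*n B T

  same-key⇒residue-> : ∀ Ba Bb → Ba < Bb → shrinkingKey Ba ≡ shrinkingKey Bb → Bb % T < Ba % T
  same-key⇒residue-> Ba Bb Ba<Bb same with <-cmp (Ba % T) (Bb % T)
  ... | tri> _ _ gt = gt
  ... | tri≈ _ j≡ _ = ⊥-elim (<-irrefl Ba≡Bb Ba<Bb)
    where
    q≡ : Ba / T ≡ Bb / T
    q≡ = +-cancelʳ-≡ _ (Ba / T) (Bb / T) (trans same (cong (λ j → Bb / T + 4 ^ j) (sym j≡)))
    Ba≡Bb : Ba ≡ Bb
    Ba≡Bb = trans (divMod Ba) (trans (cong₂ (λ j q → j + q * T) j≡ q≡) (sym (divMod Bb)))
  ... | tri< j< _ _ = ⊥-elim (<⇒≱ Ba<Bb Bb≤Ba)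
    where
    q> : Bb / T < Ba / T
    q> = ≰⇒> (λ q≤ → <⇒≢ (+-mono-≤-< q≤ (^-monoʳ-< 4 (s≤s (s≤s z≤n)) j<)) same)
    Bb≤Ba : Bb ≤ Ba
    Bb≤Ba = begin
      Bb                     ≡⟨ divMod Bb ⟩
      Bb % T + Bb / T * T    ≤⟨ +-monoˡ-≤ (Bb / T * T) (<⇒≤ (m%n<n Bb T)) ⟩
      suc (Bb / T) * T       ≤⟨ *-monoˡ-≤ T q> ⟩
      Ba / T * T             ≤⟨ m≤n+m _ _ ⟩
      Ba % T + Ba / T * T    ≡⟨ divMod Ba ⟨
      Ba                     ∎
      where open ≤-Reasoning

  same-key⇒quotient-gap : ∀ Ba Bb → Ba < Bb → shrinkingKey Ba ≡ shrinkingKey Bb →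
    Ba / T + 3 * 4 ^ (Bb % T) ≤ Bb / T
  same-key⇒quotient-gap Ba Bb Ba<Bb same = +-cancelʳ-≤ w _ _ (begin
    Ba / T + 3 * w + w       ≡⟨ +-assoc (Ba / T) (3 * w) w ⟩
    Ba / T + (3 * w + w)     ≡⟨ cong (Ba / T +_) (four-times w) ⟨
    Ba / T + 4 ^ suc (Bb % T) ≤⟨ +-monoʳ-≤ (Ba / T) (^-monoʳ-≤ 4 (same-key⇒residue-> Ba Bb Ba<Bb same)) ⟩
    Ba / T + 4 ^ (Ba % T)    ≡⟨ same ⟩
    Bb / T + w               ∎)
    where
    open ≤-Reasoning
    w = 4 ^ (Bb % T)
    four-times : ∀ w → 4 * w ≡ 3 * w + w
    four-times = solve-∀

  shrinkingKey-separated : ∀ Ba Bb → Ba < Bb → shrinkingKey Ba ≡ shrinkingKey Bb → 2 + Ba ≤ Bb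
  shrinkingKey-separated Ba Bb Ba<Bb same = begin
    2 + Ba                           ≡⟨ cong (2 +_) (divMod Ba) ⟩
    2 + (Ba % T + Ba / T * T)        ≡⟨ +-assoc 2 (Ba % T) _ ⟨
    (2 + Ba % T) + Ba / T * T        ≤⟨ +-monoˡ-≤ _ residue+2≤3T ⟩
    3 * T + Ba / T * T               ≡⟨ *-distribʳ-+ T 3 (Ba / T) ⟨
    (3 + Ba / T) * T                 ≤⟨ *-monoˡ-≤ T (subst (_≤ Bb / T) (+-comm (Ba / T) 3) q+3≤) ⟩
    Bb / T * T                       ≤⟨ m≤n+m _ _ ⟩
    Bb % T + Bb / T * T              ≡⟨ divMod Bb ⟨
    Bb                               ∎
    where
    open ≤-Reasoning
    residue+2≤3T : 2 + Ba % T ≤ 3 * T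
    residue+2≤3T = ≤-trans (+-mono-≤ (s≤s (z≤n {t})) (m%n<n Ba T)) (+-monoʳ-≤ T (m≤m+n T (T + 0)))
    q+3≤ : Ba / T + 3 ≤ Bb / T
    q+3≤ = ≤-trans (+-monoʳ-≤ (Ba / T) (*-monoʳ-≤ 3 (m^n>0 4 (Bb % T))))
             (same-key⇒quotient-gap Ba Bb Ba<Bb same)

  shrinkingKey-concave : ∀ Ba Bb Bc → Ba < Bb → Bb < Bc →
    shrinkingKey Ba ≡ shrinkingKey Bb → shrinkingKey Bb ≡ shrinkingKey Bc → Bc + Ba + 2 ≤ Bb + Bb
  shrinkingKey-concave Ba Bb Bc Ba<Bb Bb<Bc ab bc = begin
    Bc + Ba + 2                              ≡⟨ cong₂ (λ x y → x + y + 2) (divMod Bc) (divMod Ba) ⟩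
    (jc + qc * T) + (ja + qa * T) + 2        ≡⟨ regroup₁ jc qc ja qa T ⟩
    (suc jc + suc ja) + (qc * T + qa * T)    ≤⟨ +-monoˡ-≤ _ (+-mono-≤ (same-key⇒residue-> Bb Bc Bb<Bc bc) (m%n<n Ba T)) ⟩
    jb + T + (qc * T + qa * T)               ≡⟨ regroup₂ jb qc qa T ⟩
    jb + ((qc + 1) * T + qa * T)             ≤⟨ +-monoʳ-≤ jb (+-monoˡ-≤ (qa * T) (*-monoˡ-≤ T qc+1≤)) ⟩
    jb + ((qb + w) * T + qa * T)             ≡⟨ regroup₃ jb qb w qa T ⟩
    jb + qb * T + (qa + w) * T               ≤⟨ +-monoʳ-≤ (jb + qb * T) (*-monoˡ-≤ T qa+w≤) ⟩
    jb + qb * T + qb * T                     ≤⟨ +-monoʳ-≤ (jb + qb * T) (m≤n+m (qb * T) jb) ⟩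
    (jb + qb * T) + (jb + qb * T)            ≡⟨ cong₂ _+_ (divMod Bb) (divMod Bb) ⟨
    Bb + Bb                                  ∎
    where
    open ≤-Reasoning
    ja = Ba % T
    jb = Bb % T
    jc = Bc % T
    qa = Ba / T
    qb = Bb / T
    qc = Bc / T
    w = 4 ^ jb
    qa+w≤ : qa + w ≤ qb
    qa+w≤ = ≤-trans (+-monoʳ-≤ qa (m≤m+n w (w + (w + 0)))) (same-key⇒quotient-gap Ba Bb Ba<Bb ab)
    qc+1≤ : qc + 1 ≤ qb + w
    qc+1≤ = ≤-trans (+-monoʳ-≤ qc (m^n>0 4 jc)) (≤-reflexive (sym bc))
    regroup₁ : ∀ jc qc ja qa X → (jc + qc * X) + (ja + qa * X) + 2 ≡ (suc jc + suc ja) + (qc * X + qa * X)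
    regroup₁ = solve-∀
    regroup₂ : ∀ jb qc qa X → jb + X + (qc * X + qa * X) ≡ jb + ((qc + 1) * X + qa * X)
    regroup₂ = solve-∀
    regroup₃ : ∀ jb qb w qa X → jb + ((qb + w) * X + qa * X) ≡ jb + qb * X + (qa + w) * X
    regroup₃ = solve-∀

  module Mirrored (M : ℕ) where

    growingKey : ℕ → ℕ
    growingKey B = shrinkingKey (M ∸ suc B)

    private
      mirror : ∀ B → B < M → (M ∸ suc B) + suc B ≡ M
      mirror B B<M = m∸n+n≡m B<M

    mirror-< : ∀ Ba Bb → Ba < Bb → Bb < M → M ∸ suc Bb < M ∸ suc Ba
    mirror-< Ba Bb Ba<Bb Bb<M = +-cancelʳ-< (suc Ba) _ _ (begin-strict
      (M ∸ suc Bb) + suc Ba    <⟨ +-monoʳ-< (M ∸ suc Bb) (s≤s Ba<Bb) ⟩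
      (M ∸ suc Bb) + suc Bb    ≡⟨ mirror Bb Bb<M ⟩
      M                        ≡⟨ mirror Ba (<-trans Ba<Bb Bb<M) ⟨
      (M ∸ suc Ba) + suc Ba    ∎)
      where open ≤-Reasoning

    growingKey-separated : ∀ Ba Bb → Ba < Bb → Bb < M → growingKey Ba ≡ growingKey Bb → 2 + Ba ≤ Bb
    growingKey-separated Ba Bb Ba<Bb Bb<M same = +-cancelˡ-≤ b′ _ _ (+-cancelʳ-≤ 1 _ _ (begin
      b′ + (2 + Ba) + 1    ≡⟨ regroup₁ b′ Ba ⟩
      (2 + b′) + suc Ba    ≤⟨ +-monoˡ-≤ (suc Ba) (shrinkingKey-separated b′ a′ (mirror-< Ba Bb Ba<Bb Bb<M) (sym same)) ⟩
      a′ + suc Ba          ≡⟨ trans (mirror Ba (<-trans Ba<Bb Bb<M)) (sym (mirror Bb Bb<M)) ⟩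
      b′ + suc Bb          ≡⟨ regroup₂ b′ Bb ⟩
      b′ + Bb + 1          ∎))
      where
      open ≤-Reasoning
      a′ = M ∸ suc Ba
      b′ = M ∸ suc Bb
      regroup₁ : ∀ x y → x + (2 + y) + 1 ≡ (2 + x) + suc y
      regroup₁ = solve-∀
      regroup₂ : ∀ x y → x + suc y ≡ x + y + 1
      regroup₂ = solve-∀

    growingKey-convex : ∀ Ba Bb Bc → Ba < Bb → Bb < Bc → Bc < M →
      growingKey Ba ≡ growingKey Bb → growingKey Bb ≡ growingKey Bc → 2 + Bb + Bb ≤ Ba + Bc
    growingKey-convex Ba Bb Bc Ba<Bb Bb<Bc Bc<M ab bc = +-cancelˡ-≤ (b′ + b′) _ _ (begin
      (b′ + b′) + (2 + Bb + Bb)      ≡⟨ regroup₁ b′ Bb ⟩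
      (b′ + suc Bb) + (b′ + suc Bb)  ≡⟨ cong₂ _+_ (mirror Bb Bb<M) (mirror Bb Bb<M) ⟩
      M + M                          ≡⟨ cong₂ _+_ (mirror Ba Ba<M) (mirror Bc Bc<M) ⟨
      (a′ + suc Ba) + (c′ + suc Bc)  ≡⟨ regroup₂ a′ c′ Ba Bc ⟨
      (a′ + c′ + 2) + (Ba + Bc)      ≤⟨ +-monoˡ-≤ (Ba + Bc) (shrinkingKey-concave c′ b′ a′
                                          (mirror-< Bb Bc Bb<Bc Bc<M) (mirror-< Ba Bb Ba<Bb Bb<M) (sym bc) (sym ab)) ⟩
      (b′ + b′) + (Ba + Bc)          ∎)
      where
      open ≤-Reasoning
      Bb<M = <-trans Bb<Bc Bc<M
      Ba<M = <-trans Ba<Bb Bb<M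
      a′ = M ∸ suc Ba
      b′ = M ∸ suc Bb
      c′ = M ∸ suc Bc
      regroup₁ : ∀ b′ b → (b′ + b′) + (2 + b + b) ≡ (b′ + suc b) + (b′ + suc b)
      regroup₁ = solve-∀
      regroup₂ : ∀ a′ c′ a c → (a′ + c′ + 2) + (a + c) ≡ (a′ + suc a) + (c′ + suc c)
      regroup₂ = solve-∀

-- Colourings by base-M digits

digit-< : ∀ X a a′ k k′ → a < X → k < k′ → a + X * k < a′ + X * k′
digit-< X a a′ k k′ a<X k<k′ = begin-strict
  a + X * k   <⟨ +-monoˡ-< (X * k) a<X ⟩
  X + X * k   ≡⟨ *-suc X k ⟨
  X * suc k   ≤⟨ *-monoʳ-≤ X k<k′ ⟩
  X * k′      ≤⟨ m≤n+m _ _ ⟩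
  a′ + X * k′ ∎
  where open ≤-Reasoning

digits-injective : ∀ X a a′ k k′ → a < X → a′ < X → a + X * k ≡ a′ + X * k′ → a ≡ a′ × k ≡ k′
digits-injective X a a′ k k′ a<X a′<X eq with <-cmp k k′
... | tri≈ _ k≡k′ _ = +-cancelʳ-≡ _ a a′ (trans eq (cong (λ k → a′ + X * k) (sym k≡k′))) , k≡k′
... | tri< k<k′ _ _ = ⊥-elim (<-irrefl eq (digit-< X a a′ k k′ a<X k<k′))
... | tri> _ _ k′<k = ⊥-elim (<-irrefl (sym eq) (digit-< X a′ a k′ k a′<X k′<k))

-- Trend x (b − a) (c − b′), with both sides moved so that no subtraction occurs.
GapTrend : Bool → ℕ → ℕ → ℕ → ℕ → Set
GapTrend true  a b b′ c = c + a < b + b′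
GapTrend false a b b′ c = b + b′ < a + c

GapTrend-shift : ∀ x a b b′ c K {a₁ b₁ b₁′ c₁} → a₁ ≡ a + K → b₁ ≡ b + K → b₁′ ≡ b′ + K → c₁ ≡ c + K →
  GapTrend x a b b′ c → GapTrend x a₁ b₁ b₁′ c₁
GapTrend-shift true  a b b′ c K refl refl refl refl trend =
  subst₂ _<_ (interchange c a K K) (interchange b b′ K K) (+-monoˡ-< (K + K) trend)
GapTrend-shift false a b b′ c K refl refl refl refl trend =
  subst₂ _<_ (interchange b b′ K K) (interchange a c K K) (+-monoˡ-< (K + K) trend)

GapTrend⇒Trend : ∀ x a b′ Di Dj → GapTrend x a (a + Di) b′ (b′ + Dj) → Trend x Di Dj
GapTrend⇒Trend true  a b′ Di Dj trend = +-cancelˡ-< (a + b′) _ _ (subst₂ _<_ (regroup₁ a b′ Dj) (regroup₂ a b′ Di) trend)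
  where
  regroup₁ : ∀ a b′ Dj → b′ + Dj + a ≡ a + b′ + Dj
  regroup₁ = solve-∀
  regroup₂ : ∀ a b′ Di → a + Di + b′ ≡ a + b′ + Di
  regroup₂ = solve-∀
GapTrend⇒Trend false a b′ Di Dj trend = +-cancelˡ-< (a + b′) _ _ (subst₂ _<_ (regroup₁ a b′ Di) (regroup₂ a b′ Dj) trend)
  where
  regroup₁ : ∀ a b′ Di → a + Di + b′ ≡ a + b′ + Di
  regroup₁ = solve-∀
  regroup₂ : ∀ a b′ Dj → a + (b′ + Dj) ≡ a + b′ + Dj
  regroup₂ = solve-∀

module Colouring (t : ℕ) (τ : ℕ → Bool) where

  open Keys t public

  Q M C : ℕ
  Q = 4 ^ T
  M = T * Q
  C = Q + Q

  open Mirrored M public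

  instance
    Q-nonZero : NonZero Q
    Q-nonZero = m^n≢0 4 T
    M-nonZero : NonZero M
    M-nonZero = m*n≢0 T Q

  M^-nonZero : ∀ u → NonZero (M ^ u)
  M^-nonZero u = m^n≢0 M u

  infixl 7 _/M^_ _%M^_

  _/M^_ _%M^_ : ℕ → ℕ → ℕ
  n /M^ u = _/_ n (M ^ u) {{M^-nonZero u}}
  n %M^ u = _%_ n (M ^ u) {{M^-nonZero u}}

  divMod-M^ : ∀ n u → n ≡ n %M^ u + n /M^ u * M ^ u
  divMod-M^ n u = m≡m%n+[m/n]*n n (M ^ u) {{M^-nonZero u}}

  %M^< : ∀ n u → n %M^ u < M ^ u
  %M^< n u = m%n<n n (M ^ u) {{M^-nonZero u}}

  /M^< : ∀ n u → n < M ^ suc u → n /M^ u < M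
  /M^< n u n< = m<n*o⇒m/o<n {{M^-nonZero u}} n<

  /M^-mono : ∀ {n n′} u → n ≤ n′ → n /M^ u ≤ n′ /M^ u
  /M^-mono u n≤n′ = /-monoˡ-≤ (M ^ u) {{M^-nonZero u}} n≤n′

  /M^*M^≤ : ∀ n u → n /M^ u * M ^ u ≤ n
  /M^*M^≤ n u = subst (n /M^ u * M ^ u ≤_) (sym (divMod-M^ n u)) (m≤n+m _ _)

  <M^+/M^*M^ : ∀ n u → n < M ^ u + n /M^ u * M ^ u
  <M^+/M^*M^ n u = subst (_< M ^ u + n /M^ u * M ^ u) (sym (divMod-M^ n u)) (+-monoˡ-< _ (%M^< n u))

  %M^-mono-< : ∀ n n′ u → n /M^ u ≡ n′ /M^ u → n < n′ → n %M^ u < n′ %M^ u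
  %M^-mono-< n n′ u same n<n′ = +-cancelʳ-< (n /M^ u * M ^ u) _ _
    (subst₂ _<_ (divMod-M^ n u) (trans (divMod-M^ n′ u) (cong (λ d → n′ %M^ u + d * M ^ u) (sym same))) n<n′)

  %M^-mono-≤ : ∀ n n′ u → n /M^ u ≡ n′ /M^ u → n ≤ n′ → n %M^ u ≤ n′ %M^ u
  %M^-mono-≤ n n′ u same n≤n′ = +-cancelʳ-≤ (n /M^ u * M ^ u) _ _
    (subst₂ _≤_ (divMod-M^ n u) (trans (divMod-M^ n′ u) (cong (λ d → n′ %M^ u + d * M ^ u) (sym same))) n≤n′)

  /M^-< : ∀ n n′ u → n ≤ n′ → n /M^ u ≢ n′ /M^ u → n /M^ u < n′ /M^ u
  /M^-< n n′ u n≤n′ differ = ≤∧≢⇒< (/M^-mono u n≤n′) differ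

  %M^-<+⇒<+ : ∀ n n′ u → n /M^ u ≡ n′ /M^ u → ∀ X → n′ %M^ u < n %M^ u + X → n′ < n + X
  %M^-<+⇒<+ n n′ u same X n′< = begin-strict
    n′                                ≡⟨ divMod-M^ n′ u ⟩
    n′ %M^ u + n′ /M^ u * M ^ u       <⟨ +-monoˡ-< _ n′< ⟩
    n %M^ u + X + n′ /M^ u * M ^ u    ≡⟨ cong (λ d → n %M^ u + X + d * M ^ u) (sym same) ⟩
    n %M^ u + X + n /M^ u * M ^ u     ≡⟨ swap (n %M^ u) X _ ⟩
    n %M^ u + n /M^ u * M ^ u + X     ≡⟨ cong (_+ X) (divMod-M^ n u) ⟨
    n + X                             ∎
    where
    open ≤-Reasoning
    swap : ∀ a b c → a + b + c ≡ a + c + b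
    swap = solve-∀

  key : Bool → ℕ → ℕ
  key true  = shrinkingKey
  key false = growingKey

  key< : ∀ b B → B < M → key b B < C
  key< true  B B<M = shrinkingKey< B B<M
    where
    shrinkingKey< : ∀ B → B < M → shrinkingKey B < C
    shrinkingKey< B B<M = +-mono-< {B / T} {Q} {4 ^ (B % T)} {Q} (m<n*o⇒m/o<n {B} {Q} {T} (subst (B <_) (*-comm T Q) B<M))
                                   (^-monoʳ-< 4 (s≤s (s≤s z≤n)) (m%n<n B T))
  key< false B B<M = key< true (M ∸ suc B) (subst ((M ∸ suc B) <_) (m∸n+n≡m B<M) (m<m+n (M ∸ suc B) (s≤s z≤n)))

  key-separated : ∀ b Ba Bb → Ba < Bb → Bb < M → key b Ba ≡ key b Bb → 2 + Ba ≤ Bb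
  key-separated true  Ba Bb Ba<Bb Bb<M same = shrinkingKey-separated Ba Bb Ba<Bb same
  key-separated false Ba Bb Ba<Bb Bb<M same = growingKey-separated Ba Bb Ba<Bb Bb<M same

  -- For n < M ^ u, colour u n records the keys of the u base-M digits of n, each under
  -- the trend τ assigns to its position (positions count from 1).
  colour : ℕ → ℕ → ℕ
  colour zero    n = 0
  colour (suc u) n = colour u (n %M^ u) + C ^ u * key (τ (suc u)) (n /M^ u)

  -- For n, n′ < M ^ u, the position of the highest base-M digit on which n and n′
  -- differ, or 0 if n ≡ n′.
  splitLevel : ℕ → ℕ → ℕ → ℕ
  splitLevel zero    n n′ = 0
  splitLevel (suc u) n n′ with n /M^ u ≟ n′ /M^ u
  ... | yes _ = splitLevel u (n %M^ u) (n′ %M^ u)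
  ... | no  _ = suc u

  colour< : ∀ u n → n < M ^ u → colour u n < C ^ u
  colour< zero    n n<   = s≤s z≤n
  colour< (suc u) n n<   = subst (colour (suc u) n <_) (*-comm (C ^ u) C)
    (digit-< (C ^ u) _ 0 _ C (colour< u (n %M^ u) (%M^< n u)) (key< (τ (suc u)) (n /M^ u) (/M^< n u n<)))

  colour-suc-injective : ∀ u n n′ → colour (suc u) n ≡ colour (suc u) n′ →
    colour u (n %M^ u) ≡ colour u (n′ %M^ u) × key (τ (suc u)) (n /M^ u) ≡ key (τ (suc u)) (n′ /M^ u)
  colour-suc-injective u n n′ = digits-injective (C ^ u) _ _ _ _
    (colour< u (n %M^ u) (%M^< n u)) (colour< u (n′ %M^ u) (%M^< n′ u))

  splitLevel≤ : ∀ u n n′ → splitLevel u n n′ ≤ u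
  splitLevel≤ zero    n n′ = z≤n
  splitLevel≤ (suc u) n n′ with n /M^ u ≟ n′ /M^ u
  ... | yes _ = m≤n⇒m≤1+n (splitLevel≤ u (n %M^ u) (n′ %M^ u))
  ... | no  _ = ≤-refl

  splitLevel-refl : ∀ u n → splitLevel u n n ≡ 0
  splitLevel-refl zero    n = refl
  splitLevel-refl (suc u) n with n /M^ u ≟ n /M^ u
  ... | yes _     = splitLevel-refl u (n %M^ u)
  ... | no  n≢n   = ⊥-elim (n≢n refl)

  splitLevel-ultrametric : ∀ u a b c w → splitLevel u a b < w → splitLevel u b c < w → splitLevel u a c < w
  splitLevel-ultrametric zero    a b c w ab<w bc<w = ab<w
  splitLevel-ultrametric (suc u) a b c w ab<w bc<w
    with a /M^ u ≟ b /M^ u | b /M^ u ≟ c /M^ u | a /M^ u ≟ c /M^ u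
  ... | yes _  | yes _  | yes _  = splitLevel-ultrametric u (a %M^ u) (b %M^ u) (c %M^ u) w ab<w bc<w
  ... | yes ab | yes bc | no ac  = ⊥-elim (ac (trans ab bc))
  ... | no  _  | _      | yes _  = <-≤-trans (s≤s (splitLevel≤ u (a %M^ u) (c %M^ u))) (<⇒≤ ab<w)
  ... | no  _  | _      | no  _  = ab<w
  ... | yes _  | no  _  | yes _  = <-≤-trans (s≤s (splitLevel≤ u (a %M^ u) (c %M^ u))) (<⇒≤ bc<w)
  ... | yes _  | no  _  | no  _  = bc<w

  same-colour⇒splitLevel≥1 : ∀ u n n′ → n < n′ → n′ < M ^ u → colour u n ≡ colour u n′ → 1 ≤ splitLevel u n n′
  same-colour⇒splitLevel≥1 zero    n n′ n<n′ (s≤s z≤n) _ = ⊥-elim (<⇒≱ n<n′ z≤n)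
  same-colour⇒splitLevel≥1 (suc u) n n′ n<n′ n′< same with n /M^ u ≟ n′ /M^ u
  ... | yes hi≡ = same-colour⇒splitLevel≥1 u (n %M^ u) (n′ %M^ u) (%M^-mono-< n n′ u hi≡ n<n′) (%M^< n′ u)
                    (proj₁ (colour-suc-injective u n n′ same))
  ... | no  _   = s≤s z≤n

  gap<M^splitLevel : ∀ u n n′ → n ≤ n′ → n′ < M ^ u → n′ < n + M ^ splitLevel u n n′
  gap<M^splitLevel zero    n n′ n≤n′ (s≤s z≤n) = subst (0 <_) (+-comm 1 n) (s≤s z≤n)
  gap<M^splitLevel (suc u) n n′ n≤n′ n′< with n /M^ u ≟ n′ /M^ u
  ... | yes hi≡ = %M^-<+⇒<+ n n′ u hi≡ _
                    (gap<M^splitLevel u (n %M^ u) (n′ %M^ u) (%M^-mono-≤ n n′ u hi≡ n≤n′) (%M^< n′ u))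
  ... | no  _   = <-≤-trans n′< (m≤n+m _ n)

  M^splitLevel<gap : ∀ u n n′ v → n < n′ → n′ < M ^ u → colour u n ≡ colour u n′ →
    splitLevel u n n′ ≡ suc v → M ^ v + n < n′
  M^splitLevel<gap (suc u) n n′ v n<n′ n′< same split with n /M^ u ≟ n′ /M^ u
  ... | yes hi≡ = begin-strict
    M ^ v + n                            ≡⟨ cong (M ^ v +_) (divMod-M^ n u) ⟩
    M ^ v + (n %M^ u + n /M^ u * M ^ u)  ≡⟨ +-assoc (M ^ v) _ _ ⟨
    M ^ v + n %M^ u + n /M^ u * M ^ u    <⟨ +-monoˡ-< _ (M^splitLevel<gap u (n %M^ u) (n′ %M^ u) v
                                              (%M^-mono-< n n′ u hi≡ n<n′) (%M^< n′ u)
                                              (proj₁ (colour-suc-injective u n n′ same)) split) ⟩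
    n′ %M^ u + n /M^ u * M ^ u           ≡⟨ cong (λ d → n′ %M^ u + d * M ^ u) hi≡ ⟩
    n′ %M^ u + n′ /M^ u * M ^ u          ≡⟨ divMod-M^ n′ u ⟨
    n′                                   ∎
    where open ≤-Reasoning
  ... | no hi≢ with split
  ...   | refl = begin-strict
    M ^ v + n                            <⟨ +-monoʳ-< (M ^ v) (<M^+/M^*M^ n v) ⟩
    M ^ v + (M ^ v + n /M^ v * M ^ v)    ≡⟨⟩
    (2 + n /M^ v) * M ^ v                ≤⟨ *-monoˡ-≤ (M ^ v) (key-separated (τ (suc v)) (n /M^ v) (n′ /M^ v)
                                              (/M^-< n n′ v (<⇒≤ n<n′) hi≢) (/M^< n′ v n′<)
                                              (proj₂ (colour-suc-injective v n n′ same))) ⟩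
    n′ /M^ v * M ^ v                     ≤⟨ /M^*M^≤ n′ v ⟩
    n′                                   ∎
    where open ≤-Reasoning

  top-digit-trend : ∀ x u a b b′ c → a /M^ u < b /M^ u → b /M^ u ≡ b′ /M^ u → b′ /M^ u < c /M^ u →
    c /M^ u < M → key x (a /M^ u) ≡ key x (b /M^ u) → key x (b′ /M^ u) ≡ key x (c /M^ u) →
    GapTrend x a b b′ c
  top-digit-trend true u a b b′ c ab bb′ b′c c<M key-ab key-b′c = begin-strict
    c + a                                            <⟨ +-mono-< (<M^+/M^*M^ c u) (<M^+/M^*M^ a u) ⟩
    (M ^ u + Bc * M ^ u) + (M ^ u + Ba * M ^ u)      ≡⟨ regroup (M ^ u) Bc Ba ⟩
    (Bc + Ba + 2) * M ^ u                            ≤⟨ *-monoˡ-≤ (M ^ u) (shrinkingKey-concave Ba Bb Bc ab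
                                                          (subst (_< Bc) (sym bb′) b′c) key-ab
                                                          (trans (cong shrinkingKey bb′) key-b′c)) ⟩
    (Bb + Bb) * M ^ u                                ≡⟨ *-distribʳ-+ (M ^ u) Bb Bb ⟩
    Bb * M ^ u + Bb * M ^ u                          ≤⟨ +-mono-≤ (/M^*M^≤ b u)
                                                          (subst (λ d → d * M ^ u ≤ b′) (sym bb′) (/M^*M^≤ b′ u)) ⟩
    b + b′                                           ∎
    where
    open ≤-Reasoning
    Ba = a /M^ u
    Bb = b /M^ u
    Bc = c /M^ u
    regroup : ∀ X p q → (X + p * X) + (X + q * X) ≡ (p + q + 2) * X
    regroup = solve-∀
  top-digit-trend false u a b b′ c ab bb′ b′c c<M key-ab key-b′c = begin-strict
    b + b′                                           <⟨ +-mono-< (<M^+/M^*M^ b u)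
                                                          (subst (λ d → b′ < M ^ u + d * M ^ u) (sym bb′) (<M^+/M^*M^ b′ u)) ⟩
    (M ^ u + Bb * M ^ u) + (M ^ u + Bb * M ^ u)      ≡⟨ regroup (M ^ u) Bb ⟩
    (2 + Bb + Bb) * M ^ u                            ≤⟨ *-monoˡ-≤ (M ^ u) (growingKey-convex Ba Bb Bc ab
                                                          (subst (_< Bc) (sym bb′) b′c) c<M key-ab
                                                          (trans (cong growingKey bb′) key-b′c)) ⟩
    (Ba + Bc) * M ^ u                                ≡⟨ *-distribʳ-+ (M ^ u) Ba Bc ⟩
    Ba * M ^ u + Bc * M ^ u                          ≤⟨ +-mono-≤ (/M^*M^≤ a u) (/M^*M^≤ c u) ⟩
    a + c                                            ∎
    where
    open ≤-Reasoning
    Ba = a /M^ u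
    Bb = b /M^ u
    Bc = c /M^ u
    regroup : ∀ X p → (X + p * X) + (X + p * X) ≡ (2 + p + p) * X
    regroup = solve-∀

  same-level-trend : ∀ u a b b′ c v → a < b → b ≤ b′ → b′ < c → c < M ^ u →
    colour u a ≡ colour u b → colour u b′ ≡ colour u c →
    splitLevel u a b ≡ v → splitLevel u b′ c ≡ v → splitLevel u b b′ < v → GapTrend (τ v) a b b′ c
  same-level-trend zero a b b′ c v _ _ _ _ _ _ refl _ ()
  same-level-trend (suc u) a b b′ c v a<b b≤b′ b′<c c< ab b′c split-ab split-b′c split-bb′
    with a /M^ u ≟ b /M^ u | b /M^ u ≟ b′ /M^ u | b′ /M^ u ≟ c /M^ u
  ... | yes ab≡ | yes bb′≡ | yes b′c≡ =
    GapTrend-shift (τ v) _ _ _ _ (b′ /M^ u * M ^ u)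
      (reassemble a (trans ab≡ bb′≡)) (reassemble b bb′≡) (reassemble b′ refl) (reassemble c (sym b′c≡))
      (same-level-trend u (a %M^ u) (b %M^ u) (b′ %M^ u) (c %M^ u) v
        (%M^-mono-< a b u ab≡ a<b) (%M^-mono-≤ b b′ u bb′≡ b≤b′) (%M^-mono-< b′ c u b′c≡ b′<c) (%M^< c u)
        (proj₁ (colour-suc-injective u a b ab)) (proj₁ (colour-suc-injective u b′ c b′c))
        split-ab split-b′c split-bb′)
    where
    reassemble : ∀ n → n /M^ u ≡ b′ /M^ u → n ≡ n %M^ u + b′ /M^ u * M ^ u
    reassemble n same = trans (divMod-M^ n u) (cong (λ d → n %M^ u + d * M ^ u) same)
  ... | yes _ | yes _ | no _ =
    ⊥-elim (1+n≰n (≤-trans (≤-reflexive (trans split-b′c (sym split-ab))) (splitLevel≤ u (a %M^ u) (b %M^ u))))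
  ... | yes _ | no _  | _ =
    ⊥-elim (1+n≰n (≤-trans (n≤1+n (suc u))
      (≤-trans split-bb′ (≤-trans (≤-reflexive (sym split-ab)) (splitLevel≤ u (a %M^ u) (b %M^ u))))))
  ... | no _  | yes _ | yes _ =
    ⊥-elim (1+n≰n (≤-trans (≤-reflexive (trans split-ab (sym split-b′c))) (splitLevel≤ u (b′ %M^ u) (c %M^ u))))
  ... | no _  | no _  | _ = ⊥-elim (<-irrefl split-ab split-bb′)
  ... | no ab≢ | yes bb′≡ | no b′c≢ rewrite sym split-ab =
    top-digit-trend (τ (suc u)) u a b b′ c (/M^-< a b u (<⇒≤ a<b) ab≢) bb′≡ (/M^-< b′ c u (<⇒≤ b′<c) b′c≢)
      (/M^< c u c<) (proj₂ (colour-suc-injective u a b ab)) (proj₂ (colour-suc-injective u b′ c b′c))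

-- Monochromatic sequences

∈-countFrom : ∀ {j} a n → j ∈ countFrom a n → a ≤ j × j < a + n
∈-countFrom a (suc n) (here refl) = ≤-refl , subst (a <_) (sym (+-suc a n)) (s≤s (m≤m+n a n))
∈-countFrom {j} a (suc n) (there j∈) with ∈-countFrom (suc a) n j∈
... | a<j , j< = <⇒≤ a<j , subst (j <_) (sym (+-suc a n)) j<

All-map-countFrom : ∀ {A : Set} {P : A → Set} (f : ℕ → A) a n → (∀ j → a ≤ j → j < a + n → P (f j)) →
  All P (map f (countFrom a n))
All-map-countFrom f a zero    Pf = []
All-map-countFrom f a (suc n) Pf = Pf a ≤-refl (subst (a <_) (sym (+-suc a n)) (s≤s (m≤m+n a n)))
  ∷ All-map-countFrom f (suc a) n (λ j a<j j< → Pf j (<⇒≤ a<j) (subst (j <_) (sym (+-suc a n)) j<))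

module MonochromaticGaps (t s : ℕ) (ss : List ℕ) where

  open Colouring t (levelTrend (s ∷ ss)) public

  E : ℕ
  E = levelCount (s ∷ ss)

  module Gaps (k : ℕ) (P Y : ℕ → ℕ)
    (Y-increasing : ∀ j → j < k → Y j < Y (suc j))
    (Y< : ∀ j → j ≤ k → Y j < M ^ E)
    (Y-colour : ∀ j → j ≤ k → colour E (Y j) ≡ colour E (Y 0))
    (weak : ∀ i j → i < k → j < k → P j < P i → Y (suc j) ∸ Y j ≤ Y (suc i) ∸ Y i) where

    gapAt : ℕ → Gap
    gapAt j = gap (P j) (Y (suc j) ∸ Y j) (splitLevel E (Y j) (Y (suc j)))

    gaps : List Gap
    gaps = map gapAt (countFrom 0 k)

    ∈-gaps : ∀ {u} → u ∈ gaps → ∃ λ j → j < k × u ≡ gapAt j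
    ∈-gaps u∈ with ∈-map⁻ gapAt u∈
    ... | j , j∈ , u≡ = j , proj₂ (∈-countFrom 0 k j∈) , u≡

    Y+width : ∀ j → j < k → Y j + width (gapAt j) ≡ Y (suc j)
    Y+width j j<k = m+[n∸m]≡n (<⇒≤ (Y-increasing j j<k))

    Y-mono : ∀ i j → i ≤ j → j ≤ k → Y i ≤ Y j
    Y-mono i zero    z≤n _   = ≤-refl
    Y-mono i (suc j) i≤j j<k with m≤n⇒m<n∨m≡n i≤j
    ... | inj₂ refl = ≤-refl
    ... | inj₁ i<j  = ≤-trans (Y-mono i j (≤-pred i<j) (<⇒≤ j<k)) (<⇒≤ (Y-increasing j j<k))

    same-colour : ∀ i j → i ≤ k → j ≤ k → colour E (Y i) ≡ colour E (Y j)
    same-colour i j i≤k j≤k = trans (Y-colour i i≤k) (sym (Y-colour j j≤k))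

    level≥1 : ∀ j → j < k → 1 ≤ level (gapAt j)
    level≥1 j j<k = same-colour⇒splitLevel≥1 E (Y j) (Y (suc j)) (Y-increasing j j<k) (Y< (suc j) j<k)
                      (same-colour j (suc j) (<⇒≤ j<k) j<k)

    width<M^level : ∀ j → j < k → width (gapAt j) < M ^ level (gapAt j)
    width<M^level j j<k = +-cancelˡ-< (Y j) _ _ (subst (_< Y j + M ^ level (gapAt j)) (sym (Y+width j j<k))
      (gap<M^splitLevel E (Y j) (Y (suc j)) (<⇒≤ (Y-increasing j j<k)) (Y< (suc j) j<k)))

    M^level-1<width : ∀ j v → j < k → level (gapAt j) ≡ suc v → M ^ v < width (gapAt j)
    M^level-1<width j v j<k lvl = +-cancelʳ-< (Y j) _ _
      (subst (M ^ v + Y j <_) (trans (sym (Y+width j j<k)) (+-comm (Y j) _))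
        (M^splitLevel<gap E (Y j) (Y (suc j)) v (Y-increasing j j<k) (Y< (suc j) j<k)
          (same-colour j (suc j) (<⇒≤ j<k) j<k) lvl))

    wider-above : ∀ j j′ → j < k → j′ < k → level (gapAt j′) < level (gapAt j) → width (gapAt j′) < width (gapAt j)
    wider-above j j′ j<k j′<k lower with level (gapAt j) in lvl
    ... | suc v = begin-strict
      width (gapAt j′)      <⟨ width<M^level j′ j′<k ⟩
      M ^ level (gapAt j′)  ≤⟨ ^-monoʳ-≤ M (≤-pred lower) ⟩
      M ^ v                 <⟨ M^level-1<width j v j<k lvl ⟩
      width (gapAt j)       ∎
      where open ≤-Reasoning

    gaps-WiderAbove : WiderAbove gaps
    gaps-WiderAbove a∈ b∈ lower with ∈-gaps a∈ | ∈-gaps b∈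
    ... | j , j<k , refl | j′ , j′<k , refl = wider-above j j′ j<k j′<k lower

    gaps-weak : ∀ {a b} → a ∈ gaps → b ∈ gaps → value b < value a → width b ≤ width a
    gaps-weak a∈ b∈ smaller with ∈-gaps a∈ | ∈-gaps b∈
    ... | i , i<k , refl | j , j<k , refl = weak i j i<k j<k smaller

    gaps-LevelsWithin : LevelsWithin E gaps
    gaps-LevelsWithin = All-map-countFrom gapAt 0 k
      (λ j _ j<k → level≥1 j j<k , splitLevel≤ E (Y j) (Y (suc j)))

    levels-between-below : ∀ i j → i < j → j ≤ k →
      (∀ l → i < l → l < j → level (gapAt l) < level (gapAt i)) →
      splitLevel E (Y (suc i)) (Y j) < level (gapAt i)
    levels-between-below i (suc j) (s≤s i≤j) j<k below with m≤n⇒m<n∨m≡n i≤j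
    ... | inj₂ refl = subst (_< level (gapAt i)) (sym (splitLevel-refl E (Y (suc i)))) (level≥1 i j<k)
    ... | inj₁ i<j  = splitLevel-ultrametric E _ _ _ _
      (levels-between-below i j i<j (<⇒≤ j<k) (λ l i<l l<j → below l i<l (m<n⇒m<1+n l<j)))
      (below j i<j ≤-refl)

    peer-trend : ∀ i j → i < j → j < k → (∀ l → i < l → l < j → level (gapAt l) < level (gapAt i)) →
      level (gapAt j) ≡ level (gapAt i) →
      Trend (levelTrend (s ∷ ss) (level (gapAt i))) (width (gapAt i)) (width (gapAt j))
    peer-trend i j i<j j<k below same = GapTrend⇒Trend _ (Y i) (Y j) _ _
      (subst₂ (λ b c → GapTrend (levelTrend (s ∷ ss) (level (gapAt i))) (Y i) b (Y j) c) (sym (Y+width i i<k)) (sym (Y+width j j<k))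
        (same-level-trend E (Y i) (Y (suc i)) (Y j) (Y (suc j)) (level (gapAt i))
          (Y-increasing i i<k) (Y-mono (suc i) j i<j (<⇒≤ j<k)) (Y-increasing j j<k) (Y< (suc j) j<k)
          (same-colour i (suc i) (<⇒≤ i<k) i<k) (same-colour j (suc j) (<⇒≤ j<k) j<k)
          refl same (levels-between-below i j i<j (<⇒≤ j<k) below)))
      where
      i<k = <-trans i<j j<k

    next-peer-trend : ∀ i a n → i < a → a + n ≤ k → (∀ l → i < l → l < a → level (gapAt l) < level (gapAt i)) →
      NextPeerTrend (levelTrend (s ∷ ss)) (gapAt i) (map gapAt (countFrom a n))
    next-peer-trend i a zero    i<a a+n≤k below = tt
    next-peer-trend i a (suc n) i<a a+n≤k below with level (gapAt a) <ᵇ level (gapAt i) in eq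
    ... | true  = next-peer-trend i (suc a) n (m<n⇒m<1+n i<a) (subst (_≤ k) (+-suc a n) a+n≤k) below′
      where
      below′ : ∀ l → i < l → l < suc a → level (gapAt l) < level (gapAt i)
      below′ l i<l l<1+a with m≤n⇒m<n∨m≡n (≤-pred l<1+a)
      ... | inj₁ l<a  = below l i<l l<a
      ... | inj₂ refl = <ᵇ≡true⇒< _ _ eq
    ... | false = peer-trend i a i<a (<-≤-trans (s≤s (m≤m+n a n)) (subst (_≤ k) (+-suc a n) a+n≤k)) below

    gaps-PeerTrends : ∀ a n → a + n ≤ k → PeerTrends (levelTrend (s ∷ ss)) (map gapAt (countFrom a n))
    gaps-PeerTrends a zero    a+n≤k = tt
    gaps-PeerTrends a (suc n) a+n≤k =
      next-peer-trend a (suc a) n ≤-refl a+n≤k′ (λ l a<l l<1+a → ⊥-elim (<⇒≱ a<l (≤-pred l<1+a))) ,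
      gaps-PeerTrends (suc a) n a+n≤k′
      where
      a+n≤k′ = subst (_≤ k) (+-suc a n) a+n≤k

    no-weak-layered-gaps : Layered (_<_ on value) (s ∷ ss) gaps → ⊥
    no-weak-layered-gaps layered = no-weak-layered-profile s ss gaps
      (Layered-weaken (λ a∈ b∈ → gaps-weak b∈ a∈) layered) gaps-WiderAbove (gaps-PeerTrends 0 k ≤-refl)
      gaps-LevelsWithin

    no-layered-values : ∀ bs → withoutZeros bs ≡ s ∷ ss → map P (countFrom 0 k) ≡ layeredList (sum bs) bs → ⊥
    no-layered-values bs sizes values = no-weak-layered-gaps
      (subst (λ sz → Layered (_<_ on value) sz gaps) sizes
        (layeredList-Layered bs gaps (trans (sym (map-∘ (countFrom 0 k))) values)))

clampFin : (m : ℕ) → ℕ → Fin (suc m)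
clampFin m       zero    = fzero
clampFin zero    (suc j) = fzero
clampFin (suc m) (suc j) = fsuc (clampFin m j)

clampFin-toℕ : ∀ m (i : Fin (suc m)) → clampFin m (toℕ i) ≡ i
clampFin-toℕ m       fzero    = refl
clampFin-toℕ (suc m) (fsuc i) = cong fsuc (clampFin-toℕ m i)

toℕ-clampFin : ∀ m j → j ≤ m → toℕ (clampFin m j) ≡ j
toℕ-clampFin m       zero    _         = refl
toℕ-clampFin (suc m) (suc j) (s≤s j≤m) = cong suc (toℕ-clampFin m j j≤m)

clampFin-injective : ∀ m {j j′} → j ≤ m → j′ ≤ m → clampFin m j ≡ clampFin m j′ → j ≡ j′
clampFin-injective m j≤m j′≤m eq =
  trans (sym (toℕ-clampFin m _ j≤m)) (trans (cong toℕ eq) (toℕ-clampFin m _ j′≤m))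

inject₁-clampFin : ∀ m j → j ≤ m → inject₁ (clampFin m j) ≡ clampFin (suc m) j
inject₁-clampFin m       zero    _         = refl
inject₁-clampFin (suc m) (suc j) (s≤s j≤m) = cong fsuc (inject₁-clampFin m j j≤m)

map-countFrom-suc : ∀ (f : ℕ → ℕ) a n → map f (countFrom (suc a) n) ≡ map (λ j → f (suc j)) (countFrom a n)
map-countFrom-suc f a zero    = refl
map-countFrom-suc f a (suc n) = cong (f (suc a) ∷_) (map-countFrom-suc f (suc a) n)

tabulate≡map-countFrom : ∀ {m} (g : Fin m → ℕ) (f : ℕ → ℕ) → (∀ i → g i ≡ f (toℕ i)) →
  tabulate g ≡ map f (countFrom 0 m)
tabulate≡map-countFrom {zero}  g f g≡f = refl
tabulate≡map-countFrom {suc m} g f g≡f = cong₂ _∷_ (g≡f fzero)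
  (trans (tabulate≡map-countFrom (λ i → g (fsuc i)) (λ j → f (suc j)) (λ i → g≡f (fsuc i)))
         (sym (map-countFrom-suc f 0 m)))

permList≡map-countFrom : ∀ {k′} (π : Permutation′ (suc k′)) →
  permList π ≡ map (λ j → toℕ (π ⟨$⟩ʳ clampFin k′ j)) (countFrom 0 (suc k′))
permList≡map-countFrom {k′} π =
  trans (map-tabulate (λ i → i) (λ i → toℕ (π ⟨$⟩ʳ i)))
    (tabulate≡map-countFrom _ _ (λ i → cong (λ i′ → toℕ (π ⟨$⟩ʳ i′)) (sym (clampFin-toℕ k′ i))))

module WaveFreeColouring {k′} (π : Permutation′ (suc k′)) (bs : List ℕ) (sum-bs : sum bs ≡ suc k′)
  (π-layered : permList π ≡ layeredList (suc k′) bs) (s : ℕ) (ss : List ℕ) (sizes : withoutZeros bs ≡ s ∷ ss)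
  (t K r′ : ℕ) (palette : K * (4 ^ suc t + 4 ^ suc t) ^ levelCount (s ∷ ss) ≤ suc r′) where

  open MonochromaticGaps t s ss

  fullColour : ℕ → ℕ
  fullColour n = colour E (n %M^ E) + C ^ E * (n /M^ E)

  fullColour< : ∀ n → n < K * M ^ E → fullColour n < suc r′
  fullColour< n n< = begin-strict
    fullColour n                       <⟨ +-monoˡ-< _ (colour< E (n %M^ E) (%M^< n E)) ⟩
    C ^ E + C ^ E * (n /M^ E)          ≡⟨ *-suc (C ^ E) (n /M^ E) ⟨
    C ^ E * suc (n /M^ E)              ≤⟨ *-monoʳ-≤ (C ^ E) (m<n*o⇒m/o<n {{M^-nonZero E}} n<) ⟩
    C ^ E * K                          ≡⟨ *-comm (C ^ E) K ⟩
    K * C ^ E                          ≤⟨ palette ⟩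
    suc r′                             ∎
    where open ≤-Reasoning

  -- x ∸ 1 moves [1, K M ^ E] onto [0, K M ^ E), where clampFin is injective on the
  -- values of fullColour.
  χ : ℕ → Fin (suc r′)
  χ x = clampFin r′ (fullColour (x ∸ 1))

  πvalue : ℕ → ℕ
  πvalue j = toℕ (π ⟨$⟩ʳ clampFin k′ j)

  πvalues-layered : map πvalue (countFrom 0 (suc k′)) ≡ layeredList (sum bs) bs
  πvalues-layered = trans (sym (permList≡map-countFrom π)) (trans π-layered (cong (λ k → layeredList k bs) (sym sum-bs)))

  module Monochromatic (x : Fin (suc (suc k′)) → ℕ) (wave : IsWeakWave π x)
    (inside : ∀ i → 1 ≤ x i × x i ≤ K * M ^ E × χ (x i) ≡ χ (x fzero)) where

    k : ℕ
    k = suc k′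

    -- The wave as a sequence indexed by ℕ; indices past k are clamped.
    X : ℕ → ℕ
    X j = x (clampFin k j)

    n : ℕ → ℕ
    n j = X j ∸ 1

    Y : ℕ → ℕ
    Y j = n j %M^ E

    X≥1 : ∀ j → 1 ≤ X j
    X≥1 j = proj₁ (inside (clampFin k j))

    n< : ∀ j → n j < K * M ^ E
    n< j = <-≤-trans (pred< (X≥1 j)) (proj₁ (proj₂ (inside (clampFin k j))))
      where
      pred< : ∀ {a} → 1 ≤ a → a ∸ 1 < a
      pred< (s≤s _) = ≤-refl

    fullColour≡ : ∀ j → fullColour (n j) ≡ fullColour (n 0)
    fullColour≡ j = clampFin-injective r′ (≤-pred (fullColour< _ (n< j))) (≤-pred (fullColour< _ (n< 0)))
      (proj₂ (proj₂ (inside (clampFin k j))))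

    digits≡ : ∀ j → colour E (Y j) ≡ colour E (Y 0) × n j /M^ E ≡ n 0 /M^ E
    digits≡ j = digits-injective (C ^ E) _ _ _ _
      (colour< E _ (%M^< (n j) E)) (colour< E _ (%M^< (n 0) E)) (fullColour≡ j)

    same-quotient : ∀ i j → n i /M^ E ≡ n j /M^ E
    same-quotient i j = trans (proj₂ (digits≡ i)) (sym (proj₂ (digits≡ j)))

    X-increasing : ∀ j → j < k → X j < X (suc j)
    X-increasing j (s≤s j≤k′) = subst (λ i → x i < x (fsuc (clampFin k′ j)))
      (inject₁-clampFin k′ j j≤k′) (proj₁ wave (clampFin k′ j))

    Y-increasing : ∀ j → j < k → Y j < Y (suc j)
    Y-increasing j j<k = %M^-mono-< (n j) (n (suc j)) E (same-quotient j (suc j))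
      (∸-monoˡ-< (X-increasing j j<k) (X≥1 j))

    X-gap≡Y-gap : ∀ j → X (suc j) ∸ X j ≡ Y (suc j) ∸ Y j
    X-gap≡Y-gap j = begin
      X (suc j) ∸ X j                                     ≡⟨ pred-both (X≥1 j) (X≥1 (suc j)) ⟩
      n (suc j) ∸ n j                                     ≡⟨ cong₂ _∸_ (divMod-M^ (n (suc j)) E) (divMod-M^ (n j) E) ⟩
      (Y (suc j) + n (suc j) /M^ E * M ^ E) ∸ (Y j + n j /M^ E * M ^ E)
                                                          ≡⟨ cong (λ d → (Y (suc j) + d * M ^ E) ∸ (Y j + n j /M^ E * M ^ E))
                                                               (same-quotient (suc j) j) ⟩
      (Y (suc j) + n j /M^ E * M ^ E) ∸ (Y j + n j /M^ E * M ^ E)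
                                                          ≡⟨ cong₂ _∸_ (+-comm (Y (suc j)) _) (+-comm (Y j) _) ⟩
      (n j /M^ E * M ^ E + Y (suc j)) ∸ (n j /M^ E * M ^ E + Y j)
                                                          ≡⟨ [m+n]∸[m+o]≡n∸o (n j /M^ E * M ^ E) (Y (suc j)) (Y j) ⟩
      Y (suc j) ∸ Y j                                     ∎
      where
      open ≡-Reasoning
      pred-both : ∀ {a b} → 1 ≤ a → 1 ≤ b → b ∸ a ≡ (b ∸ 1) ∸ (a ∸ 1)
      pred-both (s≤s _) (s≤s _) = refl

    diff≡Y-gap : ∀ j → j < k → diff x (clampFin k′ j) ≡ Y (suc j) ∸ Y j
    diff≡Y-gap j (s≤s j≤k′) =
      trans (cong (λ i → x (fsuc (clampFin k′ j)) ∸ x i) (inject₁-clampFin k′ j j≤k′)) (X-gap≡Y-gap j)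

    Y-weak : ∀ i j → i < k → j < k → πvalue j < πvalue i → Y (suc j) ∸ Y j ≤ Y (suc i) ∸ Y i
    Y-weak i j i<k j<k smaller = subst₂ _≤_ (diff≡Y-gap j j<k) (diff≡Y-gap i i<k)
      (proj₂ wave (clampFin k′ i) (clampFin k′ j) smaller)

    contradiction : ⊥
    contradiction = Gaps.no-layered-values k πvalue Y Y-increasing (λ j _ → %M^< (n j) E)
      (λ j _ → proj₁ (digits≡ j)) Y-weak bs sizes πvalues-layered

  no-monochromatic-weak-wave : ¬ Forces (IsWeakWave π) (suc r′) (K * M ^ E)
  no-monochromatic-weak-wave forces with forces χ
  ... | x , wave , inside = Monochromatic.contradiction x wave inside

-- Choice of parameters

2*⌊n/2⌋≤n : ∀ n → 2 * ⌊ n /2⌋ ≤ n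
2*⌊n/2⌋≤n n = begin
  2 * ⌊ n /2⌋        ≡⟨ cong (⌊ n /2⌋ +_) (+-identityʳ ⌊ n /2⌋) ⟩
  ⌊ n /2⌋ + ⌊ n /2⌋  ≤⟨ +-monoʳ-≤ ⌊ n /2⌋ (⌊n/2⌋≤⌈n/2⌉ n) ⟩
  ⌊ n /2⌋ + ⌈ n /2⌉  ≡⟨ ⌊n/2⌋+⌈n/2⌉≡n n ⟩
  n                  ∎
  where open ≤-Reasoning

2^⌊log₂⌋≤ : ∀ n → 1 ≤ n → 2 ^ ⌊log₂ n ⌋ ≤ n
2^⌊log₂⌋≤ n 1≤n = 2^L≤ ⌊log₂ n ⌋ n 1≤n refl
  where
  2^L≤ : ∀ L m → 1 ≤ m → ⌊log₂ m ⌋ ≡ L → 2 ^ L ≤ m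
  2^L≤ zero    m             1≤m _  = 1≤m
  2^L≤ (suc L) 1             _   eq = ⊥-elim (0≢1+n (trans (sym (⌊log₂[2^n]⌋≡n 0)) eq))
  2^L≤ (suc L) (suc (suc m)) _   eq = begin
    2 * 2 ^ L                ≤⟨ *-monoʳ-≤ 2 (2^L≤ L (suc ⌊ m /2⌋) (s≤s z≤n)
                                  (trans (⌊log₂⌊n/2⌋⌋≡⌊log₂n⌋∸1 (suc (suc m))) (cong (_∸ 1) eq))) ⟩
    2 * ⌊ suc (suc m) /2⌋    ≤⟨ 2*⌊n/2⌋≤n (suc (suc m)) ⟩
    suc (suc m)              ∎
    where open ≤-Reasoning

m<[1+m/n]*n : ∀ m n .{{_ : NonZero n}} → m < suc (m / n) * n
m<[1+m/n]*n m n = begin-strict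
  m                  ≡⟨ m≡m%n+[m/n]*n m n ⟩
  m % n + m / n * n  <⟨ +-monoˡ-< (m / n * n) (m%n<n m n) ⟩
  n + m / n * n      ∎
  where open ≤-Reasoning

m≤2*[m/n*n] : ∀ m n .{{_ : NonZero n}} → n ≤ m → m ≤ 2 * (m / n * n)
m≤2*[m/n*n] m n n≤m = begin
  m                          ≤⟨ <⇒≤ (m<[1+m/n]*n m n) ⟩
  n + m / n * n              ≤⟨ +-monoˡ-≤ (m / n * n) (≤-trans (≤-reflexive (sym (*-identityˡ n)))
                                  (*-monoˡ-≤ n (m≥n⇒m/n>0 n≤m))) ⟩
  m / n * n + m / n * n      ≡⟨ cong (m / n * n +_) (+-identityʳ (m / n * n)) ⟨
  2 * (m / n * n)            ∎
  where open ≤-Reasoning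

[m*n]^o≡m^o*n^o : ∀ m n o → (m * n) ^ o ≡ m ^ o * n ^ o
[m*n]^o≡m^o*n^o m n zero    = refl
[m*n]^o≡m^o*n^o m n (suc o) rewrite [m*n]^o≡m^o*n^o m n o = *-interchange m n (m ^ o) (n ^ o)
  where
  *-interchange : ∀ a b x y → a * b * (x * y) ≡ a * x * (b * y)
  *-interchange = solve-∀

palette≤2^ : ∀ t E → (4 ^ suc t + 4 ^ suc t) ^ E * 2 ≤ 2 ^ (suc t * (6 * suc E))
palette≤2^ t E = begin
  (4 ^ T + 4 ^ T) ^ E * 2         ≡⟨ cong (λ c → c ^ E * 2) (trans (doubling (4 ^ T)) (cong (2 *_) (^-*-assoc 2 2 T))) ⟩
  (2 ^ (1 + 2 * T)) ^ E * 2 ^ 1   ≡⟨ cong (_* 2 ^ 1) (^-*-assoc 2 (1 + 2 * T) E) ⟩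
  2 ^ ((1 + 2 * T) * E) * 2 ^ 1   ≡⟨ ^-distribˡ-+-* 2 ((1 + 2 * T) * E) 1 ⟨
  2 ^ ((1 + 2 * T) * E + 1)       ≤⟨ ^-monoʳ-≤ 2 (≤-trans (m≤m+n ((1 + 2 * T) * E + 1) _) (≤-reflexive (sym (expand t E)))) ⟩
  2 ^ (T * (6 * suc E))           ∎
  where
  open ≤-Reasoning
  T = suc t
  doubling : ∀ q → q + q ≡ 2 * q
  doubling = solve-∀
  expand : ∀ t E → suc t * (6 * suc E) ≡ ((1 + 2 * suc t) * E + 1) + (4 * t * E + 6 * t + 3 * E + 5)
  expand = solve-∀

-- T ≈ ⌊log₂ r⌋ / 6(E + 1) makes the palette (2 · 4 ^ T) ^ E at most r / 2 while
-- keeping ⌊log₂ r⌋ within a constant factor of T.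
scale-for : ∀ E r → 2 ^ (6 * suc E) ≤ r →
  ∃ λ t → (4 ^ suc t + 4 ^ suc t) ^ E * 2 ≤ r × ⌊log₂ r ⌋ ≤ 12 * suc E * suc t
scale-for E r r≥ = choose (L / d) refl
  where
  L = ⌊log₂ r ⌋
  d = 6 * suc E
  d≤L : d ≤ L
  d≤L = subst (_≤ L) (⌊log₂[2^n]⌋≡n d) (⌊log₂⌋-mono-≤ r≥)
  choose : ∀ T → L / d ≡ T → ∃ λ t → (4 ^ suc t + 4 ^ suc t) ^ E * 2 ≤ r × L ≤ 12 * suc E * suc t
  choose zero    eq = ⊥-elim (<⇒≱ (m≥n⇒m/n>0 d≤L) (≤-reflexive eq))
  choose (suc t) eq = t , palette≤ , L≤
    where
    open ≤-Reasoning
    T = suc t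
    palette≤ : (4 ^ T + 4 ^ T) ^ E * 2 ≤ r
    palette≤ = begin
      (4 ^ T + 4 ^ T) ^ E * 2   ≤⟨ palette≤2^ t E ⟩
      2 ^ (T * d)               ≤⟨ ^-monoʳ-≤ 2 (subst (λ q → q * d ≤ L) eq (m/n*n≤m L d)) ⟩
      2 ^ L                     ≤⟨ 2^⌊log₂⌋≤ r (≤-trans (m^n>0 2 d) r≥) ⟩
      r                         ∎
    L≤ : L ≤ 12 * suc E * T
    L≤ = begin
      L                   ≤⟨ <⇒≤ (m<[1+m/n]*n L d) ⟩
      suc (L / d) * d     ≡⟨ cong (λ q → suc q * d) eq ⟩
      suc T * d           ≤⟨ *-monoˡ-≤ d (s≤s (m≤n+m T t)) ⟩
      (T + T) * d         ≡⟨ regroup T E ⟩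
      12 * suc E * T      ∎
      where
      regroup : ∀ T E → (T + T) * (6 * suc E) ≡ 12 * suc E * T
      regroup = solve-∀

r*⌊log₂r⌋^E≤ : ∀ E r N → 2 ^ (6 * suc E) ≤ r →
  (∀ t K → K * (4 ^ suc t + 4 ^ suc t) ^ E ≤ r → K * (suc t * 4 ^ suc t) ^ E < N) →
  r * ⌊log₂ r ⌋ ^ E ≤ 2 * (24 * suc E) ^ E * N
r*⌊log₂r⌋^E≤ E r N r≥ no-colouring with scale-for E r r≥
... | t , palette≤ , L≤ = begin
  r * ⌊log₂ r ⌋ ^ E                           ≤⟨ *-mono-≤ (m≤2*[m/n*n] r g (≤-trans (m≤m*n g 2) palette≤))
                                                           (^-monoˡ-≤ E L≤) ⟩
  2 * (K * g) * (A * T) ^ E                   ≡⟨ regroup₁ K g ((A * T) ^ E) ⟩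
  2 * K * ((A * T) ^ E * g)                   ≡⟨ cong (2 * K *_) ([m*n]^o≡m^o*n^o (A * T) (Q + Q) E) ⟨
  2 * K * (A * T * (Q + Q)) ^ E               ≡⟨ cong (λ b → 2 * K * b ^ E) (regroup₂ A T Q) ⟩
  2 * K * (2 * A * (T * Q)) ^ E               ≡⟨ cong (2 * K *_) ([m*n]^o≡m^o*n^o (2 * A) (T * Q) E) ⟩
  2 * K * ((2 * A) ^ E * (T * Q) ^ E)         ≡⟨ regroup₃ K ((2 * A) ^ E) ((T * Q) ^ E) ⟩
  2 * (2 * A) ^ E * (K * (T * Q) ^ E)         ≤⟨ *-monoʳ-≤ (2 * (2 * A) ^ E) (<⇒≤ (no-colouring t K (m/n*n≤m r g))) ⟩
  2 * (2 * A) ^ E * N                         ≡⟨ cong (λ c → 2 * c ^ E * N) (twice-twelve E) ⟩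
  2 * (24 * suc E) ^ E * N                    ∎
  where
  open ≤-Reasoning
  T = suc t
  Q = 4 ^ T
  A = 12 * suc E
  g = (Q + Q) ^ E
  instance
    g-nonZero : NonZero g
    g-nonZero = m^n≢0 (Q + Q) E {{>-nonZero (≤-trans (m^n>0 4 T) (m≤m+n Q Q))}}
  K = r / g
  regroup₁ : ∀ K g x → 2 * (K * g) * x ≡ 2 * K * (x * g)
  regroup₁ = solve-∀
  regroup₂ : ∀ A T Q → A * T * (Q + Q) ≡ 2 * A * (T * Q)
  regroup₂ = solve-∀
  regroup₃ : ∀ K a b → 2 * K * (a * b) ≡ 2 * a * (K * b)
  regroup₃ = solve-∀
  twice-twelve : ∀ E → 2 * (12 * suc E) ≡ 24 * suc E
  twice-twelve = solve-∀

-- Waves versus weak waves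

Forces-mono : ∀ {k} {W : (Fin (suc k) → ℕ) → Set} {r N M} → N ≤ M → Forces W r N → Forces W r M
Forces-mono N≤M forces χ with forces χ
... | x , w , inside = x , w , λ i → proj₁ (inside i) , ≤-trans (proj₁ (proj₂ (inside i))) N≤M , proj₂ (proj₂ (inside i))

Forces-weaken : ∀ {k} {W W′ : (Fin (suc k) → ℕ) → Set} {r M} → (∀ {x} → W x → W′ x) → Forces W r M → Forces W′ r M
Forces-weaken W⇒W′ forces χ with forces χ
... | x , w , inside = x , W⇒W′ w , inside

wave⇒weakWave : ∀ {k} (π : Permutation′ k) {x} → IsWave π x → IsWeakWave π x
wave⇒weakWave π (increasing , ordered) = increasing , λ i j smaller → <⇒≤ (proj₂ (ordered i j) smaller)

Pweak≤P : ∀ {k} (π : Permutation′ k) r M N → IsP π r M → IsPweak π r N → N ≤ M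
Pweak≤P π r M N (M≥1 , forces , _) (_ , _ , least) = least M M≥1 (Forces-weaken (λ {x} → wave⇒weakWave π {x}) forces)

layer-sizes : ∀ bs k′ → sum bs ≡ suc k′ → ∃₂ λ s ss → withoutZeros bs ≡ s ∷ ss
layer-sizes bs k′ sum-bs with withoutZeros bs in sizes
... | []     = ⊥-elim (0≢1+n (trans (cong sum (sym sizes)) (trans (sum-withoutZeros bs) sum-bs)))
... | s ∷ ss = s , ss , refl

exponent≡levelCount : ∀ {k′} (π : Permutation′ (suc k′)) bs → sum bs ≡ suc k′ →
  permList π ≡ layeredList (suc k′) bs → ∀ s ss → withoutZeros bs ≡ s ∷ ss →
  suc k′ ∸ numBigNonFinal π ∸ 1 ≡ levelCount (s ∷ ss)
exponent≡levelCount {k′} π bs sum-bs π-layered s ss sizes = begin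
  suc k′ ∸ ℓ ∸ 1          ≡⟨ cong (λ k → k ∸ ℓ ∸ 1) k≡ ⟩
  E + 1 + ℓ ∸ ℓ ∸ 1       ≡⟨ cong (_∸ 1) (m+n∸n≡m (E + 1) ℓ) ⟩
  E + 1 ∸ 1               ≡⟨ m+n∸n≡m E 1 ⟩
  E                       ∎
  where
  open ≡-Reasoning
  E = levelCount (s ∷ ss)
  ℓ = numBigNonFinal π
  layer-lengths : map length (layers (permList π)) ≡ s ∷ ss
  layer-lengths = trans (cong (λ l → map length (layers l)) (trans π-layered (cong (λ k → layeredList k bs) (sym sum-bs))))
                    (trans (proj₁ (layers-layeredList bs)) sizes)
  ℓ≡ : ℓ ≡ bigNonFinal (s ∷ ss)
  ℓ≡ = trans (bigNonFinal-layers (layers (permList π))) (cong bigNonFinal layer-lengths)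
  k≡ : suc k′ ≡ E + 1 + ℓ
  k≡ = begin
    suc k′                          ≡⟨ trans (sym sum-bs) (sym (sum-withoutZeros bs)) ⟩
    sum (withoutZeros bs)           ≡⟨ cong sum sizes ⟩
    sum (s ∷ ss)                    ≡⟨ levelCount+1+bigNonFinal s ss (subst (All (1 ≤_)) sizes (withoutZeros-positive bs)) ⟨
    E + 1 + bigNonFinal (s ∷ ss)    ≡⟨ cong (E + 1 +_) ℓ≡ ⟨
    E + 1 + ℓ                       ∎

Pweak-lower-bound : ∀ {k′} (π : Permutation′ (suc k′)) bs → sum bs ≡ suc k′ →
  permList π ≡ layeredList (suc k′) bs → ∀ s ss → withoutZeros bs ≡ s ∷ ss →
  ∀ r → 2 ^ (6 * suc (levelCount (s ∷ ss))) ≤ r → ∀ N → IsPweak π r N →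
  r * ⌊log₂ r ⌋ ^ levelCount (s ∷ ss) ≤ 2 * (24 * suc (levelCount (s ∷ ss))) ^ levelCount (s ∷ ss) * N
Pweak-lower-bound π bs sum-bs π-layered s ss sizes zero     r≥ N _ = ⊥-elim (<⇒≱ (m^n>0 2 (6 * suc (levelCount (s ∷ ss)))) r≥)
Pweak-lower-bound π bs sum-bs π-layered s ss sizes (suc r′) r≥ N (_ , forces , _) =
  r*⌊log₂r⌋^E≤ (levelCount (s ∷ ss)) (suc r′) N r≥ λ t K palette → ≰⇒> λ N≤ →
    WaveFreeColouring.no-monochromatic-weak-wave π bs sum-bs π-layered s ss sizes t K r′ palette
      (Forces-mono N≤ forces)

lemma4p6 : (k : ℕ) → 1 ≤ k → (π : Permutation′ k) → IsLayered π →
    ((r : ℕ) → 1 < r → (M N : ℕ) → IsP π r M → IsPweak π r N → N ≤ M)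
    × Σ ℕ (λ c → Σ ℕ (λ R₀ → (r : ℕ) → R₀ ≤ r → (N : ℕ) → IsPweak π r N →
        r * ⌊log₂ r ⌋ ^ (k ∸ numBigNonFinal π ∸ 1) ≤ c * N))
lemma4p6 (suc k′) _ π (bs , sum-bs , π-layered) with layer-sizes bs k′ sum-bs
... | s , ss , sizes =
  (λ r _ → Pweak≤P π r) ,
  2 * (24 * suc E) ^ E , 2 ^ (6 * suc E) , λ r r≥ N pweak →
    subst (λ e → r * ⌊log₂ r ⌋ ^ e ≤ 2 * (24 * suc E) ^ E * N)
      (sym (exponent≡levelCount π bs sum-bs π-layered s ss sizes))
      (Pweak-lower-bound π bs sum-bs π-layered s ss sizes r r≥ N pweak)
  where
  E = levelCount (s ∷ ss)
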